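{- Let $\lambda=(m,n)$ be a triangular $2$-partition. Then the top-down tableau of $\lambda$ is the maximal row-regular tableau of $\lambda$ (the $i$-row-regular tableau with $i=m-2(n-1)$): the labels of the upper row are $m-n+2,m-n+4,\dots,m+n$ and the labels of the bottom row are $1,2,\dots,m-n,m-n+1,m-n+3,\dots,m+n-1$. In particular, the top-down tableau of $\lambda$ is sim-sym.
   Context: Partitions are drawn in French convention: cell $(\ell,c)$ ($\ell\ge0$ row from bottom, $c\ge0$ column) belongs to $\lambda$ iff $c<\lambda_{\ell+1}$. A $2$-partition $(m,n)$ has $m\ge n\ge0$. A partition is triangular if there exist positive reals $r,s$ with $\lambda_j=\lfloor r-jr/s\rfloor$ for $1\le j\le s$ and $\lambda_j=0$ for $j>s$. The top-down tableau of a partition of size $N$ labels with $N$ the last cell of the top row, with $N-1$ the last cell of the row below, and so on, one cell per nonempty row down to the bottom, then repeats on the remaining cells with the next smaller labels. For $1\le i\le m-2(n-1)$, the $i$-row-regular tableau of $(m,n)$ is the standard Young tableau with upper-row labels $n+i,n+i+2,\dots,n+i+2(n-1)$. Sim-sym: for a cell $c$ of a partition $\mu$ with arm $a(c)$ and leg $\ell(c)$ (cells of $\mu$ strictly right in its row, resp. strictly above in its column), $v^-(c,\mu)=\ell(c)/(a(c)+\ell(c)+1)$, $v^+(c,\mu)=(\ell(c)+1)/(a(c)+\ell(c)+1)$, $v^\pm_\lambda$ are the max of $v^-(c,\lambda)$ and min of $v^+(c,\lambda)$ over cells of $\lambda$; a cell $c$ of a subpartition $\mu\subseteq\lambda$ is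 similar if $v^-(c,\mu)<\frac{v^-_\lambda+v^+_\lambda}{2}\le v^+(c,\mu)$, $\mathrm{sim}(\lambda,\mu)$ counts similar cells, $\mathrm{area}(\lambda,\mu)=|\lambda|-|\mu|$, $A_\lambda(q,t)=\sum_{\mu\subseteq\lambda}q^{\mathrm{area}}t^{\mathrm{sim}}$. For a standard tableau $\theta$, a cell $d$ is a $\theta$-deficit cell of $(\lambda,\mu)$ if there are $c_1=(i_1,j_1)\in\mu$, $c_2=(i_2,j_2)\in\lambda\setminus\mu$ with $\theta(c_1)>\theta(c_2)$ and $d=(\min(i_1,i_2),\min(j_1,j_2))$; $\mathrm{sim}_\theta(\mu)$ counts cells of $\mu$ that are not $\theta$-deficit cells; $A_\theta(q,t)=\sum_{\mu\subseteq\lambda}q^{\mathrm{area}(\lambda,\mu)}t^{\mathrm{sim}_\theta(\mu)}$; $\theta$ is sim-sym if $A_\theta=A_\lambda$.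
   Formalization: The parameters r and s witnessing that λ is triangular range over the positive rationals instead of the positive reals. -}

module Defs where

open import Data.Nat as ℕ using (ℕ; zero; suc; _+_; _*_; _∸_; _≡ᵇ_; _<ᵇ_)
open import Data.Integer as ℤ using (ℤ; +_)
open import Data.Rational as ℚ using (ℚ; _/_; _÷_; _⊔_; _⊓_; 0ℚ; 1ℚ; ½; floor; Positive)
open import Data.Rational.Properties using (_<?_; _≤?_; pos⇒nonZero)
open import Data.Bool using (Bool; true; false; if_then_else_; not; _∧_; _∨_)
open import Data.List using (List; []; _∷_; map; concatMap; upTo; length; foldr)
open import Data.Nat.ListAction using (sum)
open import Data.Bool.ListAction using (any)
open import Data.Product using (_×_; _,_; Σ; ∃; proj₁; proj₂)
open import Relation.Nullary using (does)
open import Relation.Binary.PropositionalEquality using (_≡_)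

countᵇ : {A : Set} → (A → Bool) → List A → ℕ
countᵇ p []       = 0
countᵇ p (x ∷ xs) = if p x then suc (countᵇ p xs) else countᵇ p xs

filterᵇ : {A : Set} → (A → Bool) → List A → List A
filterᵇ p []       = []
filterᵇ p (x ∷ xs) = if p x then x ∷ filterᵇ p xs else filterᵇ p xs

-- n-th element (0-based) with default 0
nth : List ℕ → ℕ → ℕ
nth []       _       = 0
nth (x ∷ _)  zero    = x
nth (_ ∷ xs) (suc k) = nth xs k

-- A partition is given by its list of row lengths, bottom row first:
-- ρ = λ₁ ∷ λ₂ ∷ …  (row ℓ, counted from 0 at the bottom, has length λ_{ℓ+1}).
-- A cell is (ℓ , c) : ℕ × ℕ ; it belongs to ρ iff c < λ_{ℓ+1}.

Cell : Set
Cell = ℕ × ℕ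

rowLen : List ℕ → ℕ → ℕ
rowLen = nth

part₂ : ℕ → ℕ → List ℕ
part₂ m n = m ∷ n ∷ []

size : List ℕ → ℕ
size = sum

cells : List ℕ → List Cell
cells ρ = concatMap (λ ℓ → map (λ c → (ℓ , c)) (upTo (rowLen ρ ℓ))) (upTo (length ρ))

inShapeᵇ : List ℕ → Cell → Bool
inShapeᵇ ρ (ℓ , c) = c <ᵇ rowLen ρ ℓ

rowsAbove : List ℕ → ℕ → List ℕ
rowsAbove ρ ℓ = map (λ k → suc ℓ + k) (upTo (length ρ ∸ suc ℓ))

arm : List ℕ → Cell → ℕ
arm ρ (ℓ , c) = rowLen ρ ℓ ∸ suc c

leg : List ℕ → Cell → ℕ
leg ρ (ℓ , c) = countᵇ (λ ℓ' → c <ᵇ rowLen ρ ℓ') (rowsAbove ρ ℓ)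

partPart : List ℕ → ℕ → ℕ
partPart ρ j = rowLen ρ (j ∸ 1)

ℕ→ℚ : ℕ → ℚ
ℕ→ℚ j = + j / 1

divPos : (x s : ℚ) → Positive s → ℚ
divPos x s ps = _÷_ x s {{pos⇒nonZero s {{ps}}}}

Triangular : List ℕ → Set
Triangular ρ =
  Σ ℚ λ r → Σ ℚ λ s → Positive r × Σ (Positive s) λ ps →
    (j : ℕ) → 1 ℕ.≤ j →
      (ℕ→ℚ j ℚ.≤ s → + (partPart ρ j) ≡ floor (r ℚ.- divPos (ℕ→ℚ j ℚ.* r) s ps))
    × (s ℚ.< ℕ→ℚ j → partPart ρ j ≡ 0)

-- Tableaux: a labelling of cells by natural numbers (only the values on the
-- cells of the shape matter).

Tableau : Set
Tableau = Cell → ℕ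

-- Top-down tableau, following the procedure literally: label N the last cell
-- of the top nonempty row, N-1 the last cell of the next nonempty row below,
-- …, down to the bottom row; then repeat on the remaining cells (every
-- nonempty row shortened by one) with the next smaller labels.
topDownAux : ℕ → List ℕ → ℕ → Tableau
topDownAux zero     ρ N cell = 0
topDownAux (suc f) ρ N (ℓ , c) =
  if suc c ≡ᵇ rowLen ρ ℓ
  then N ∸ countᵇ (λ ℓ' → 0 <ᵇ rowLen ρ ℓ') (rowsAbove ρ ℓ)
  else topDownAux f (map (λ x → x ∸ 1) ρ) (N ∸ countᵇ (λ x → 0 <ᵇ x) ρ) (ℓ , c)

topDown : List ℕ → Tableau
topDown ρ = topDownAux (suc (size ρ)) ρ (size ρ)

-- i-row-regular tableau of the 2-partition (m , n): upper row (row 1) gets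
-- n+i, n+i+2, …, n+i+2(n-1); the bottom row gets the remaining labels of
-- {1, …, m+n} in increasing order (the unique standard filling).
isUpperLabel : ℕ → ℕ → ℕ → Bool
isUpperLabel n i k = any (λ j → k ≡ᵇ n + i + 2 * j) (upTo n)

rowRegular : ℕ → ℕ → ℕ → Tableau
rowRegular m n i (zero , c)        =
  nth (filterᵇ (λ k → not (isUpperLabel n i k)) (map suc (upTo (m + n)))) c
rowRegular m n i (suc zero , c)    = n + i + 2 * c
rowRegular m n i (suc (suc _) , c) = 0

v⁻ : List ℕ → Cell → ℚ
v⁻ μ x = + leg μ x / suc (arm μ x + leg μ x)

v⁺ : List ℕ → Cell → ℚ
v⁺ μ x = + suc (leg μ x) / suc (arm μ x + leg μ x)

-- max of v⁻ over cells (all values are ≥ 0, so the seed 0 is harmless)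
v⁻max : List ℕ → ℚ
v⁻max λ' = foldr _⊔_ 0ℚ (map (v⁻ λ') (cells λ'))

-- min of v⁺ over cells (all values are ≤ 1, so the seed 1 is harmless)
v⁺min : List ℕ → ℚ
v⁺min λ' = foldr _⊓_ 1ℚ (map (v⁺ λ') (cells λ'))

similarᵇ : List ℕ → List ℕ → Cell → Bool
similarᵇ λ' μ x =
  does (v⁻ μ x <? mid) ∧ does (mid ≤? v⁺ μ x)
  where mid = (v⁻max λ' ℚ.+ v⁺min λ') ℚ.* ½

sim : List ℕ → List ℕ → ℕ
sim λ' μ = countᵇ (similarᵇ λ' μ) (cells μ)

area : List ℕ → List ℕ → ℕ
area λ' μ = size λ' ∸ size μ

_≡ᶜ_ : Cell → Cell → Bool
(a , b) ≡ᶜ (a' , b') = (a ≡ᵇ a') ∧ (b ≡ᵇ b')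

deficitᵇ : Tableau → List ℕ → List ℕ → Cell → Bool
deficitᵇ θ λ' μ d =
  any (λ c₁ → any (λ c₂ →
          not (inShapeᵇ μ c₂) ∧ (θ c₂ <ᵇ θ c₁)
          ∧ (d ≡ᶜ (proj₁ c₁ ℕ.⊓ proj₁ c₂ , proj₂ c₁ ℕ.⊓ proj₂ c₂)))
        (cells λ'))
      (cells μ)

simθ : Tableau → List ℕ → List ℕ → ℕ
simθ θ λ' μ = countᵇ (λ x → not (deficitᵇ θ λ' μ x)) (cells μ)

-- Generating functions for a 2-partition (m , n).
-- Subpartitions μ ⊆ (m , n) are exactly the 2-partitions (p , q) with
-- q ≤ p ≤ m and q ≤ n.

subpartitions₂ : ℕ → ℕ → List (List ℕ)
subpartitions₂ m n =
  concatMap (λ p → map (λ q → part₂ p q) (upTo (suc (p ℕ.⊓ n)))) (upTo (suc m))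

-- A polynomial Σ_μ q^{a(μ)} t^{b(μ)} is represented by its list of exponent
-- pairs; coeff L a b is the coefficient of q^a t^b.
coeff : List (ℕ × ℕ) → ℕ → ℕ → ℕ
coeff L a b = countᵇ (λ e → (proj₁ e ≡ᵇ a) ∧ (proj₂ e ≡ᵇ b)) L

A-λ₂ : ℕ → ℕ → List (ℕ × ℕ)
A-λ₂ m n = map (λ μ → area (part₂ m n) μ , sim (part₂ m n) μ) (subpartitions₂ m n)

A-θ₂ : ℕ → ℕ → Tableau → List (ℕ × ℕ)
A-θ₂ m n θ = map (λ μ → area (part₂ m n) μ , simθ θ (part₂ m n) μ) (subpartitions₂ m n)

SimSym₂ : ℕ → ℕ → Tableau → Set
SimSym₂ m n θ = (a b : ℕ) → coeff (A-θ₂ m n θ) a b ≡ coeff (A-λ₂ m n) a b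

module Submission where

-- Write d = m − n. Peeling the top-down labels off two per round gives the upper row d + 2, d + 4, …
-- and the bottom row 1, …, d, d + 1, d + 3, …, which is the row-regular tableau with first upper label
-- n + i = d + 2. Triangularity forces n ≤ d + 1: the parts are the floors of the affine function
-- j ↦ r − jr/s, whose value at 2 is the mean of its values at 1 (less than m + 1) and at 3 (less than 1).
--
-- For a subpartition (p, q) both statistics count the q upper cells plus the bottom cells outside a gap.
-- A bottom cell k is θ-deficit iff either k < q and p ≤ d + k (with p < m), or q ≤ k < n and
-- d + k + 1 < p, so simθ (p, q) = p for p ≤ d and simθ (d + P, q) = d + min (2P, 2q + 1). A cell of leg
-- at most 1 is similar according to how its hook compares with a = ⌊1/M⌋, where M is the midpoint of
-- v⁻max and v⁺min, so sim (p, q) = p for p < a and sim (a + P, q) = a + min (2P + 1, 2q). If n < d then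
-- a = d, and the generating functions agree after exchanging (d + P, q) with (d + q, P); if
-- d ≤ n ≤ d + 1 then a = d + 1 and the statistics agree on every subpartition; if n = 0 then a = 2m.

open import Defs

open import Data.Bool using (Bool; true; false; T; not; if_then_else_; _∧_)
open import Data.Bool.Properties using (T-∧)
open import Data.Bool.ListAction using (any)
open import Data.Empty using (⊥-elim)
open import Data.Unit using (tt)
open import Data.Fin using (toℕ)
open import Data.Fin.Properties using (toℕ<n)
open import Data.Integer as ℤ using (+≤+; +<+)
import Data.Integer.DivMod as ℤ
open import Data.Integer.Properties using (pos-*; pos-+)
import Data.Integer.Properties as ℤₚ
open import Data.List using (List; []; _∷_; _++_; map; concatMap; foldr; applyUpTo; upTo; length; [_])
open import Data.List.Membership.Propositional using (_∈_; lose; find)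
open import Data.List.Membership.Propositional.Properties
  using (∈-applyUpTo⁻; ∈-upTo⁺; ∈-upTo⁻; ∈-map⁺; ∈-map⁻; ∈-++⁺ˡ; ∈-++⁺ʳ; ∈-++⁻; ∈-concatMap⁻)
open import Data.List.Properties
  using (concatMap-++; length-applyUpTo; length-upTo; ++-identityʳ; ++-assoc; applyUpTo-∷ʳ; map-upTo)
open import Data.List.Relation.Unary.Any using (here; there)
open import Data.List.Relation.Unary.Any.Properties using (any⁺; any⁻)
open import Data.Nat using (ℕ; zero; suc; pred; _+_; _*_; _∸_; _⊓_; _≤_; _<_; _≡ᵇ_; _<ᵇ_; z≤n; s≤s; z<s; NonZero)
open import Data.Nat.DivMod using (_%_; [m+kn]%n≡m%n; m*n%n≡0)
open import Data.Nat.Properties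
open import Algebra.Properties.CommutativeSemigroup +-commutativeSemigroup using (x∙yz≈y∙xz)
open import Algebra.Properties.CommutativeMonoid.Sum +-0-commutativeMonoid using (sum-syntax; ∑-comm; sum-cong-≗)
open import Data.Nat.Tactic.RingSolver using (solve-∀)
open import Data.Product using (_×_; _,_; ∃; ∃₂; proj₁; proj₂)
open import Data.Rational as ℚ using (ℚ; mkℚ; _/_; ½; 0ℚ; 1ℚ; toℚᵘ; floor; Positive)
import Data.Rational.Properties as ℚₚ
open import Data.Rational.Solver using (module +-*-Solver)
open import Data.Rational.Unnormalised as ℚᵘ using (mkℚᵘ; *≤*; *<*; *≡*)
import Data.Rational.Unnormalised.Properties as ℚᵘₚ
open import Data.Sum using (_⊎_; inj₁; inj₂; [_,_]′)
open import Function using (_∘_; _∘′_; id; Equivalence; _⇔_; mk⇔)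
open import Relation.Binary.PropositionalEquality hiding ([_])
open import Relation.Nullary using (¬_; contradiction; Dec; yes; no; does)

open Equivalence using (to; from)

private
  variable
    A B : Set

any-∈ : (f : A → Bool) {x : A} {xs : List A} → x ∈ xs → T (f x) → T (any f xs)
any-∈ f x∈xs fx = any⁺ f (lose x∈xs fx)

any-witness : (f : A → Bool) (xs : List A) → T (any f xs) → ∃ λ x → x ∈ xs × T (f x)
any-witness f xs = find ∘ any⁻ f xs

if-true : ∀ {b} {x y : A} → T b → (if b then x else y) ≡ x
if-true {b = true} _ = refl

if-false : ∀ {b} {x y : A} → ¬ T b → (if b then x else y) ≡ y
if-false {b = false} _  = refl
if-false {b = true}  ¬b = contradiction _ ¬b

T-not : ∀ {b} → ¬ T b → T (not b)
T-not {false} _  = tt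
T-not {true}  ¬b = ¬b tt

¬T-not : ∀ {b} → T b → ¬ T (not b)
¬T-not {true} _ ()

T-does⁺ : ∀ {P : Set} (P? : Dec P) → P → T (does P?)
T-does⁺ (yes _) _ = tt
T-does⁺ (no ¬p) p = ¬p p

T-does⁻ : ∀ {P : Set} (P? : Dec P) → T (does P?) → P
T-does⁻ (yes p) _ = p

≢⇒¬≡ᵇ : ∀ {m n} → m ≢ n → ¬ T (m ≡ᵇ n)
≢⇒¬≡ᵇ {m} {n} m≢n = m≢n ∘ ≡ᵇ⇒≡ m n

countᵇ-++ : (p : A → Bool) (xs ys : List A) → countᵇ p (xs ++ ys) ≡ countᵇ p xs + countᵇ p ys
countᵇ-++ p []       ys = refl
countᵇ-++ p (x ∷ xs) ys with p x
... | true  = cong suc (countᵇ-++ p xs ys)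
... | false = countᵇ-++ p xs ys

countᵇ-map : (p : B → Bool) (f : A → B) (xs : List A) → countᵇ p (map f xs) ≡ countᵇ (p ∘ f) xs
countᵇ-map p f []       = refl
countᵇ-map p f (x ∷ xs) with p (f x)
... | true  = cong suc (countᵇ-map p f xs)
... | false = countᵇ-map p f xs

countᵇ-cong : (p q : A → Bool) (xs : List A) → (∀ {x} → x ∈ xs → p x ≡ q x) → countᵇ p xs ≡ countᵇ q xs
countᵇ-cong p q []       p≗q = refl
countᵇ-cong p q (x ∷ xs) p≗q with p x | q x | p≗q (here refl)
... | true  | true  | _ = cong suc (countᵇ-cong p q xs (p≗q ∘ there))
... | false | false | _ = countᵇ-cong p q xs (p≗q ∘ there)

countᵇ-all : (p : A → Bool) (xs : List A) → (∀ {x} → x ∈ xs → T (p x)) → countᵇ p xs ≡ length xs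
countᵇ-all p []       all = refl
countᵇ-all p (x ∷ xs) all with p x | all (here refl)
... | true | _ = cong suc (countᵇ-all p xs (all ∘ there))

countᵇ-none : (p : A → Bool) (xs : List A) → (∀ {x} → x ∈ xs → ¬ T (p x)) → countᵇ p xs ≡ 0
countᵇ-none p []       none = refl
countᵇ-none p (x ∷ xs) none with p x | none (here refl)
... | false | _   = countᵇ-none p xs (none ∘ there)
... | true  | ¬px = contradiction _ ¬px

applyUpTo-+ : (f : ℕ → A) (m n : ℕ) → applyUpTo f (m + n) ≡ applyUpTo f m ++ applyUpTo (f ∘ (m +_)) n
applyUpTo-+ f zero    n = refl
applyUpTo-+ f (suc m) n = cong (f 0 ∷_) (applyUpTo-+ (f ∘ suc) m n)

countᵇ-upTo-gap : (p : ℕ → Bool) {x x′ n : ℕ} → x ≤ x′ → x′ ≤ n →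
  (∀ {k} → k < x → T (p k)) →
  (∀ {k} → x ≤ k → k < x′ → ¬ T (p k)) →
  (∀ {k} → x′ ≤ k → k < n → T (p k)) →
  countᵇ p (upTo n) ≡ x + (n ∸ x′)
countᵇ-upTo-gap p {x} {x′} {n} x≤x′ x′≤n before inside after with x′ ∸ x | m+[n∸m]≡n x≤x′
... | y | refl with n ∸ (x + y) | m+[n∸m]≡n x′≤n
... | z | refl = begin
  countᵇ p (upTo (x + y + z))
    ≡⟨ cong (countᵇ p) (trans (applyUpTo-+ id (x + y) z) (cong (_++ applyUpTo (x + y +_) z) (applyUpTo-+ id x y))) ⟩
  countᵇ p ((upTo x ++ applyUpTo (x +_) y) ++ applyUpTo (x + y +_) z)
    ≡⟨ trans (countᵇ-++ p (upTo x ++ applyUpTo (x +_) y) _)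
         (cong (_+ countᵇ p (applyUpTo (x + y +_) z)) (countᵇ-++ p (upTo x) _)) ⟩
  countᵇ p (upTo x) + countᵇ p (applyUpTo (x +_) y) + countᵇ p (applyUpTo (x + y +_) z)
    ≡⟨ cong₂ _+_ (cong₂ _+_ all-before none-inside) all-after ⟩
  x + 0 + z
    ≡⟨ cong (_+ z) (+-identityʳ x) ⟩
  x + z ∎
  where
  open ≡-Reasoning
  all-before : countᵇ p (upTo x) ≡ x
  all-before = trans (countᵇ-all p (upTo x) (before ∘ ∈-upTo⁻)) (length-upTo x)
  none-inside : countᵇ p (applyUpTo (x +_) y) ≡ 0
  none-inside = countᵇ-none p _ λ k∈ →
    let i , i<y , k≡ = ∈-applyUpTo⁻ (x +_) k∈
    in subst (¬_ ∘ T ∘ p) (sym k≡) (inside (m≤m+n x i) (+-monoʳ-< x i<y))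
  all-after : countᵇ p (applyUpTo (x + y +_) z) ≡ z
  all-after = trans (countᵇ-all p _ λ k∈ →
      let i , i<z , k≡ = ∈-applyUpTo⁻ (x + y +_) k∈
      in subst (T ∘ p) (sym k≡) (after (m≤m+n (x + y) i) (+-monoʳ-< (x + y) i<z)))
    (length-applyUpTo _ z)

countᵇ-applyUpTo : (p : A → Bool) (f : ℕ → A) (k : ℕ) → countᵇ p (applyUpTo f k) ≡ ∑[ i < k ] countᵇ p [ f (toℕ i) ]
countᵇ-applyUpTo p f zero    = refl
countᵇ-applyUpTo p f (suc k) with p (f 0)
... | true  = cong suc (countᵇ-applyUpTo p (f ∘ suc) k)
... | false = countᵇ-applyUpTo p (f ∘ suc) k

countᵇ-concatMap-applyUpTo : (p : B → Bool) (g : A → List B) (f : ℕ → A) (k : ℕ) →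
  countᵇ p (concatMap g (applyUpTo f k)) ≡ ∑[ i < k ] countᵇ p (g (f (toℕ i)))
countᵇ-concatMap-applyUpTo p g f zero    = refl
countᵇ-concatMap-applyUpTo p g f (suc k) =
  trans (countᵇ-++ p (g (f 0)) _) (cong (countᵇ p (g (f 0)) +_) (countᵇ-concatMap-applyUpTo p g (f ∘ suc) k))

filterᵇ-++ : (p : A → Bool) (xs ys : List A) → filterᵇ p (xs ++ ys) ≡ filterᵇ p xs ++ filterᵇ p ys
filterᵇ-++ p []       ys = refl
filterᵇ-++ p (x ∷ xs) ys with p x
... | true  = cong (x ∷_) (filterᵇ-++ p xs ys)
... | false = filterᵇ-++ p xs ys

filterᵇ-all : (p : A → Bool) (xs : List A) → (∀ {x} → x ∈ xs → T (p x)) → filterᵇ p xs ≡ xs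
filterᵇ-all p []       all = refl
filterᵇ-all p (x ∷ xs) all = trans (if-true (all (here refl))) (cong (x ∷_) (filterᵇ-all p xs (all ∘ there)))

nth-++ˡ : ∀ xs ys {c} → c < length xs → nth (xs ++ ys) c ≡ nth xs c
nth-++ˡ (x ∷ xs) ys {zero}  _         = refl
nth-++ˡ (x ∷ xs) ys {suc c} (s≤s c<n) = nth-++ˡ xs ys c<n

nth-++ʳ : ∀ xs ys c → nth (xs ++ ys) (length xs + c) ≡ nth ys c
nth-++ʳ []       ys c = refl
nth-++ʳ (x ∷ xs) ys c = nth-++ʳ xs ys c

nth-applyUpTo : ∀ (f : ℕ → ℕ) {n c} → c < n → nth (applyUpTo f n) c ≡ f c
nth-applyUpTo f {suc n} {zero}  _         = refl
nth-applyUpTo f {suc n} {suc c} (s≤s c<n) = nth-applyUpTo (f ∘ suc) c<n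

-- The top-down tableau of a 2-partition

topDownAux-not-last : ∀ {ℓ c} j a b → c < rowLen (a ∷ b ∷ []) ℓ →
  ¬ T (suc c ≡ᵇ rowLen (suc j + a ∷ suc j + b ∷ []) ℓ)
topDownAux-not-last {zero}          j a b c<a = ≢⇒¬≡ᵇ (<⇒≢ (<-≤-trans c<a (m≤n+m a j)))
topDownAux-not-last {suc zero}      j a b c<b = ≢⇒¬≡ᵇ (<⇒≢ (<-≤-trans c<b (m≤n+m b j)))
topDownAux-not-last {suc (suc ℓ)}   j a b ()

topDownAux-peel₂ : ∀ {ℓ c} j a b F N → c < rowLen (a ∷ b ∷ []) ℓ →
  topDownAux (j + F) (j + a ∷ j + b ∷ []) (j + j + N) (ℓ , c) ≡ topDownAux F (a ∷ b ∷ []) N (ℓ , c)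
topDownAux-peel₂         zero    a b F N c<len = refl
topDownAux-peel₂ {ℓ} {c} (suc j) a b F N c<len = begin
  topDownAux (suc j + F) (suc j + a ∷ suc j + b ∷ []) (suc j + suc j + N) (ℓ , c)
    ≡⟨ if-false (topDownAux-not-last {ℓ} j a b c<len) ⟩
  topDownAux (j + F) (j + a ∷ j + b ∷ []) ((j + suc j + N) ∸ 1) (ℓ , c)
    ≡⟨ cong (λ N′ → topDownAux (j + F) (j + a ∷ j + b ∷ []) (N′ ∸ 1) (ℓ , c)) (cong (_+ N) (+-suc j j)) ⟩
  topDownAux (j + F) (j + a ∷ j + b ∷ []) (j + j + N) (ℓ , c)
    ≡⟨ topDownAux-peel₂ j a b F N c<len ⟩
  topDownAux F (a ∷ b ∷ []) N (ℓ , c) ∎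
  where open ≡-Reasoning

topDownAux-peel₁ : ∀ {c} j a F N → c < a →
  topDownAux (j + F) (j + a ∷ 0 ∷ []) (j + N) (0 , c) ≡ topDownAux F (a ∷ 0 ∷ []) N (0 , c)
topDownAux-peel₁ zero    a F N c<a = refl
topDownAux-peel₁ (suc j) a F N c<a =
  trans (if-false (topDownAux-not-last {0} j a 0 c<a)) (topDownAux-peel₁ j a F N c<a)

topDownAux-last-top : ∀ a c F N → topDownAux (suc F) (a ∷ suc c ∷ []) N (1 , c) ≡ N
topDownAux-last-top a c F N = if-true (≡⇒≡ᵇ c c refl)

topDownAux-last-bottom : ∀ c b F N → topDownAux (suc F) (suc c ∷ suc b ∷ []) N (0 , c) ≡ N ∸ 1
topDownAux-last-bottom c b F N = if-true (≡⇒≡ᵇ c c refl)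

topDownAux-last-single : ∀ c F N → topDownAux (suc F) (suc c ∷ 0 ∷ []) N (0 , c) ≡ N
topDownAux-last-single c F N = if-true (≡⇒≡ᵇ c c refl)

topDown-top : ∀ d n {c} → c < n → topDown (part₂ (d + n) n) (1 , c) ≡ d + 2 + 2 * c
topDown-top d n {c} c<n with n ∸ suc c | m∸n+n≡m c<n
... | j | refl = begin
  topDown (d + (j + suc c) ∷ j + suc c ∷ []) (1 , c)
    ≡⟨ cong (λ a → topDown (a ∷ j + suc c ∷ []) (1 , c)) (x∙yz≈y∙xz d j (suc c)) ⟩
  topDown ρ (1 , c)
    ≡⟨ cong₂ (λ F N → topDownAux F ρ N (1 , c)) (fuel j d c) (labels j d c) ⟩
  topDownAux (j + suc (d + suc c + (j + suc c + 0))) ρ (j + j + (d + suc c + suc c)) (1 , c)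
    ≡⟨ topDownAux-peel₂ j (d + suc c) (suc c) _ _ (n<1+n c) ⟩
  topDownAux (suc (d + suc c + (j + suc c + 0))) (d + suc c ∷ suc c ∷ []) (d + suc c + suc c) (1 , c)
    ≡⟨ topDownAux-last-top (d + suc c) c (d + suc c + (j + suc c + 0)) (d + suc c + suc c) ⟩
  d + suc c + suc c
    ≡⟨ value d c ⟩
  d + 2 + 2 * c ∎
  where
  open ≡-Reasoning
  ρ : List ℕ
  ρ = j + (d + suc c) ∷ j + suc c ∷ []
  fuel : ∀ j d c → suc (j + (d + suc c) + (j + suc c + 0)) ≡ j + suc (d + suc c + (j + suc c + 0))
  fuel = solve-∀
  labels : ∀ j d c → j + (d + suc c) + (j + suc c + 0) ≡ j + j + (d + suc c + suc c)
  labels = solve-∀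
  value : ∀ d c → d + suc c + suc c ≡ d + 2 + 2 * c
  value = solve-∀

topDown-bottom-high : ∀ d n {g} → g < n → topDown (part₂ (d + n) n) (0 , d + g) ≡ d + 1 + 2 * g
topDown-bottom-high d n {g} g<n with n ∸ suc g | m∸n+n≡m g<n
... | j | refl = begin
  topDown (d + (j + suc g) ∷ j + suc g ∷ []) (0 , d + g)
    ≡⟨ cong (λ a → topDown (a ∷ j + suc g ∷ []) (0 , d + g)) (shape j d g) ⟩
  topDown ρ (0 , d + g)
    ≡⟨ cong₂ (λ F N → topDownAux F ρ N (0 , d + g)) (fuel j d g) (labels j d g) ⟩
  topDownAux (j + suc (suc (d + g) + (j + suc g + 0))) ρ (j + j + (suc (d + g) + suc g)) (0 , d + g)
    ≡⟨ topDownAux-peel₂ j (suc (d + g)) (suc g) _ _ (n<1+n (d + g)) ⟩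
  topDownAux (suc (suc (d + g) + (j + suc g + 0))) (suc (d + g) ∷ suc g ∷ []) (suc (d + g) + suc g) (0 , d + g)
    ≡⟨ topDownAux-last-bottom (d + g) g (suc (d + g) + (j + suc g + 0)) (suc (d + g) + suc g) ⟩
  d + g + suc g
    ≡⟨ value d g ⟩
  d + 1 + 2 * g ∎
  where
  open ≡-Reasoning
  ρ : List ℕ
  ρ = j + suc (d + g) ∷ j + suc g ∷ []
  shape : ∀ j d g → d + (j + suc g) ≡ j + suc (d + g)
  shape = solve-∀
  fuel : ∀ j d g → suc (j + suc (d + g) + (j + suc g + 0)) ≡ j + suc (suc (d + g) + (j + suc g + 0))
  fuel = solve-∀
  labels : ∀ j d g → j + suc (d + g) + (j + suc g + 0) ≡ j + j + (suc (d + g) + suc g)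
  labels = solve-∀
  value : ∀ d g → d + g + suc g ≡ d + 1 + 2 * g
  value = solve-∀

topDown-bottom-low : ∀ d n {c} → c < d → topDown (part₂ (d + n) n) (0 , c) ≡ suc c
topDown-bottom-low d n {c} c<d with d ∸ suc c | m∸n+n≡m c<d
... | j | refl = begin
  topDown (j + suc c + n ∷ n ∷ []) (0 , c)
    ≡⟨ cong₂ (λ a b → topDown (a ∷ b ∷ []) (0 , c)) (+-comm (j + suc c) n) (sym (+-identityʳ n)) ⟩
  topDown ρ (0 , c)
    ≡⟨ cong₂ (λ F N → topDownAux F ρ N (0 , c)) (fuel n j c) (labels n j c) ⟩
  topDownAux (n + (j + suc (suc (c + n)))) ρ (n + n + (j + suc c)) (0 , c)
    ≡⟨ topDownAux-peel₂ n (j + suc c) 0 _ _ (m≤n+m (suc c) j) ⟩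
  topDownAux (j + suc (suc (c + n))) (j + suc c ∷ 0 ∷ []) (j + suc c) (0 , c)
    ≡⟨ topDownAux-peel₁ j (suc c) _ _ (n<1+n c) ⟩
  topDownAux (suc (suc (c + n))) (suc c ∷ 0 ∷ []) (suc c) (0 , c)
    ≡⟨ topDownAux-last-single c (suc (c + n)) (suc c) ⟩
  suc c ∎
  where
  open ≡-Reasoning
  ρ : List ℕ
  ρ = n + (j + suc c) ∷ n + 0 ∷ []
  fuel : ∀ n j c → suc (n + (j + suc c) + (n + 0 + 0)) ≡ n + (j + suc (suc (c + n)))
  fuel = solve-∀
  labels : ∀ n j c → n + (j + suc c) + (n + 0 + 0) ≡ n + n + (j + suc c)
  labels = solve-∀

topDown-bottom-beyond : ∀ d n c → d ≤ c → c < d + n → topDown (part₂ (d + n) n) (0 , c) ≡ d + 1 + 2 * (c ∸ d)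
topDown-bottom-beyond d n c d≤c c<m = subst (λ x → topDown (part₂ (d + n) n) (0 , x) ≡ d + 1 + 2 * (c ∸ d)) (m+[n∸m]≡n d≤c)
  (topDown-bottom-high d n (+-cancelˡ-< d (c ∸ d) n (subst (_< d + n) (sym (m+[n∸m]≡n d≤c)) c<m)))

topDown-bottom : ∀ d n {j} → j < d + n → topDown (part₂ (d + n) n) (0 , j) ≡ suc j + (j ∸ d)
topDown-bottom d n {j} j<m with j <? d
... | yes j<d = trans (topDown-bottom-low d n j<d) (sym (trans (cong (suc j +_) (m≤n⇒m∸n≡0 (<⇒≤ j<d))) (+-identityʳ (suc j))))
... | no j≮d with j ∸ d | m+[n∸m]≡n (≮⇒≥ j≮d)
...   | g | refl = trans (topDown-bottom-high d n (+-cancelˡ-< d g n j<m)) (value d g)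
  where
  value : ∀ d g → d + 1 + 2 * g ≡ suc (d + g) + g
  value = solve-∀

record TopDownOrdered (d n : ℕ) (θ : Tableau) : Set where
  field
    bottom-<     : ∀ {j j′} → j < j′ → j′ < d + n → θ (0 , j) < θ (0 , j′)
    top-<        : ∀ {k k′} → k < k′ → k′ < n → θ (1 , k) < θ (1 , k′)
    bottom-<-top : ∀ {j k} → k < n → j ≤ d + k → θ (0 , j) < θ (1 , k)
    top-<-bottom : ∀ {j k} → j < d + n → d + k < j → θ (1 , k) < θ (0 , j)

topDown-ordered : ∀ d n → TopDownOrdered d n (topDown (part₂ (d + n) n))
topDown-ordered d n = record
  { bottom-<     = λ {j} {j′} j<j′ j′<m → subst₂ _<_ (sym (topDown-bottom d n (<-trans j<j′ j′<m))) (sym (topDown-bottom d n j′<m))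
                     (+-mono-<-≤ (s≤s j<j′) (∸-monoˡ-≤ d (<⇒≤ j<j′)))
  ; top-<        = λ {k} {k′} k<k′ k′<n → subst₂ _<_ (sym (topDown-top d n (<-trans k<k′ k′<n))) (sym (topDown-top d n k′<n))
                     (+-monoʳ-< (d + 2) (*-monoʳ-< 2 k<k′))
  ; bottom-<-top = bottom-<-top
  ; top-<-bottom = top-<-bottom
  }
  where
  open ≤-Reasoning
  bottom-<-top : ∀ {j k} → k < n → j ≤ d + k → topDown (part₂ (d + n) n) (0 , j) < topDown (part₂ (d + n) n) (1 , k)
  bottom-<-top {j} {k} k<n j≤d+k = begin-strict
    topDown (part₂ (d + n) n) (0 , j)  ≡⟨ topDown-bottom d n (≤-<-trans j≤d+k (+-monoʳ-< d k<n)) ⟩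
    suc j + (j ∸ d)                    ≤⟨ +-mono-≤ (s≤s j≤d+k)
                                            (≤-trans (∸-monoˡ-≤ d j≤d+k) (≤-reflexive (m+n∸m≡n d k))) ⟩
    suc (d + k) + k                    <⟨ n<1+n _ ⟩
    suc (suc (d + k) + k)              ≡⟨ value d k ⟩
    d + 2 + 2 * k                      ≡⟨ topDown-top d n k<n ⟨
    topDown (part₂ (d + n) n) (1 , k)  ∎
    where
    value : ∀ d k → suc (suc (d + k) + k) ≡ d + 2 + 2 * k
    value = solve-∀
  top-<-bottom : ∀ {j k} → j < d + n → d + k < j → topDown (part₂ (d + n) n) (1 , k) < topDown (part₂ (d + n) n) (0 , j)
  top-<-bottom {j} {k} j<m d+k<j = begin-strict
    topDown (part₂ (d + n) n) (1 , k)  ≡⟨ topDown-top d n (+-cancelˡ-< d k n (<-trans d+k<j j<m)) ⟩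
    d + 2 + 2 * k                      ≡⟨ value d k ⟩
    suc (suc (d + k)) + k              <⟨ +-monoʳ-< (suc (suc (d + k))) (n<1+n k) ⟩
    suc (suc (d + k)) + suc k          ≤⟨ +-mono-≤ (s≤s d+k<j) (≤-trans (≤-reflexive (sym (m+n∸m≡n d (suc k))))
                                            (∸-monoˡ-≤ d (subst (_≤ j) (sym (+-suc d k)) d+k<j))) ⟩
    suc j + (j ∸ d)                    ≡⟨ topDown-bottom d n j<m ⟨
    topDown (part₂ (d + n) n) (0 , j)  ∎
    where
    value : ∀ d k → d + 2 + 2 * k ≡ suc (suc (d + k)) + k
    value = solve-∀

-- Row-regular tableaux

odd≢even : ∀ a b → 1 + a * 2 ≢ b * 2
odd≢even a b eq = 1≢0 (trans (sym ([m+kn]%n≡m%n 1 a 2)) (trans (cong (_% 2) eq) (m*n%n≡0 b 2)))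
  where
  1≢0 : 1 ≢ 0
  1≢0 ()

isUpperLabel⁺ : ∀ n i {j} → j < n → T (isUpperLabel n i (n + i + 2 * j))
isUpperLabel⁺ n i {j} j<n = any-∈ _ (∈-upTo⁺ j<n) (≡⇒≡ᵇ (n + i + 2 * j) _ refl)

¬isUpperLabel : ∀ n i {k} → (∀ j → k ≢ n + i + 2 * j) → ¬ T (isUpperLabel n i k)
¬isUpperLabel n i {k} k≢ upper = let j , _ , k≡ = any-witness _ (upTo n) upper in k≢ j (≡ᵇ⇒≡ _ _ k≡)

module RowRegularBottom (n i d : ℕ) (first-upper : n + i ≡ d + 2) where

  private
    lower : ℕ → Bool
    lower k = not (isUpperLabel n i k)

    lower-small : ∀ {t} → t < d → T (lower (suc t))
    lower-small {t} t<d = T-not (¬isUpperLabel n i λ j → <⇒≢ (below-upper j))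
      where
      open ≤-Reasoning
      below-upper : ∀ j → suc t < n + i + 2 * j
      below-upper j = begin-strict
        suc t           ≤⟨ t<d ⟩
        d               <⟨ m<m+n d z<s ⟩
        d + 2           ≡⟨ first-upper ⟨
        n + i           ≤⟨ m≤m+n (n + i) (2 * j) ⟩
        n + i + 2 * j   ∎

    lower-odd : ∀ K → T (lower (d + 1 + 2 * K))
    lower-odd K = T-not (¬isUpperLabel n i λ j eq →
      odd≢even K (suc j) (+-cancelˡ-≡ d _ _ (trans (odd d K) (trans eq (trans (cong (_+ 2 * j) first-upper) (even d j))))))
      where
      odd : ∀ d K → d + (1 + K * 2) ≡ d + 1 + 2 * K
      odd = solve-∀
      even : ∀ d j → d + 2 + 2 * j ≡ d + suc j * 2
      even = solve-∀

    upper-even : ∀ {K} → K < n → ¬ T (lower (d + 2 + 2 * K))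
    upper-even {K} K<n = ¬T-not (subst (λ u → T (isUpperLabel n i (u + 2 * K))) first-upper (isUpperLabel⁺ n i K<n))

  lower-labels : ∀ K → K ≤ n → filterᵇ lower (applyUpTo suc (d + 2 * K)) ≡ applyUpTo suc d ++ applyUpTo (λ j → d + 1 + 2 * j) K
  lower-labels zero    _   = begin
    filterᵇ lower (applyUpTo suc (d + 0))
      ≡⟨ cong (filterᵇ lower ∘ applyUpTo suc) (+-identityʳ d) ⟩
    filterᵇ lower (applyUpTo suc d)
      ≡⟨ filterᵇ-all lower _ (λ t∈ → let t , t<d , eq = ∈-applyUpTo⁻ suc t∈ in subst (T ∘ lower) (sym eq) (lower-small t<d)) ⟩
    applyUpTo suc d
      ≡⟨ ++-identityʳ _ ⟨
    applyUpTo suc d ++ [] ∎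
    where open ≡-Reasoning
  lower-labels (suc K) K<n = begin
    filterᵇ lower (applyUpTo suc (d + 2 * suc K))
      ≡⟨ cong (filterᵇ lower ∘ applyUpTo suc) (two-more d K) ⟩
    filterᵇ lower (applyUpTo suc (d + 2 * K + 2))
      ≡⟨ cong (filterᵇ lower) (applyUpTo-+ suc (d + 2 * K) 2) ⟩
    filterᵇ lower (applyUpTo suc (d + 2 * K) ++ suc (d + 2 * K + 0) ∷ suc (d + 2 * K + 1) ∷ [])
      ≡⟨ filterᵇ-++ lower (applyUpTo suc (d + 2 * K)) _ ⟩
    filterᵇ lower (applyUpTo suc (d + 2 * K)) ++ filterᵇ lower (suc (d + 2 * K + 0) ∷ suc (d + 2 * K + 1) ∷ [])
      ≡⟨ cong₂ _++_ (lower-labels K (<⇒≤ K<n)) pair ⟩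
    (applyUpTo suc d ++ applyUpTo (λ j → d + 1 + 2 * j) K) ++ [ d + 1 + 2 * K ]
      ≡⟨ ++-assoc (applyUpTo suc d) _ _ ⟩
    applyUpTo suc d ++ (applyUpTo (λ j → d + 1 + 2 * j) K ++ [ d + 1 + 2 * K ])
      ≡⟨ cong (applyUpTo suc d ++_) (applyUpTo-∷ʳ (λ j → d + 1 + 2 * j) K) ⟩
    applyUpTo suc d ++ applyUpTo (λ j → d + 1 + 2 * j) (suc K) ∎
    where
    open ≡-Reasoning
    two-more : ∀ d K → d + 2 * suc K ≡ d + 2 * K + 2
    two-more = solve-∀
    odd-label : ∀ d K → suc (d + 2 * K + 0) ≡ d + 1 + 2 * K
    odd-label = solve-∀
    even-label : ∀ d K → suc (d + 2 * K + 1) ≡ d + 2 + 2 * K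
    even-label = solve-∀
    pair : filterᵇ lower (suc (d + 2 * K + 0) ∷ suc (d + 2 * K + 1) ∷ []) ≡ [ d + 1 + 2 * K ]
    pair rewrite odd-label d K | even-label d K =
      trans (if-true (lower-odd K)) (cong (d + 1 + 2 * K ∷_) (if-false (upper-even K<n)))

  module _ where

    private
      bottom-row : ∀ c → rowRegular (d + n) n i (0 , c) ≡ nth (applyUpTo suc d ++ applyUpTo (λ j → d + 1 + 2 * j) n) c
      bottom-row c = cong (λ L → nth L c) (begin
        filterᵇ lower (map suc (upTo (d + n + n)))
          ≡⟨ cong (filterᵇ lower) (map-upTo suc (d + n + n)) ⟩
        filterᵇ lower (applyUpTo suc (d + n + n))
          ≡⟨ cong (filterᵇ lower ∘ applyUpTo suc) (total d n) ⟩
        filterᵇ lower (applyUpTo suc (d + 2 * n))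
          ≡⟨ lower-labels n ≤-refl ⟩
        applyUpTo suc d ++ applyUpTo (λ j → d + 1 + 2 * j) n ∎)
        where
        open ≡-Reasoning
        total : ∀ d n → d + n + n ≡ d + 2 * n
        total = solve-∀

    rowRegular-bottom-low : ∀ {c} → c < d → rowRegular (d + n) n i (0 , c) ≡ suc c
    rowRegular-bottom-low {c} c<d = begin
      rowRegular (d + n) n i (0 , c)
        ≡⟨ bottom-row c ⟩
      nth (applyUpTo suc d ++ applyUpTo (λ j → d + 1 + 2 * j) n) c
        ≡⟨ nth-++ˡ (applyUpTo suc d) _ (subst (c <_) (sym (length-applyUpTo suc d)) c<d) ⟩
      nth (applyUpTo suc d) c
        ≡⟨ nth-applyUpTo suc c<d ⟩
      suc c ∎
      where open ≡-Reasoning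

    rowRegular-bottom-high : ∀ g → g < n → rowRegular (d + n) n i (0 , d + g) ≡ d + 1 + 2 * g
    rowRegular-bottom-high g g<n = begin
      rowRegular (d + n) n i (0 , d + g)
        ≡⟨ bottom-row (d + g) ⟩
      nth (applyUpTo suc d ++ applyUpTo (λ j → d + 1 + 2 * j) n) (d + g)
        ≡⟨ cong (λ k → nth (applyUpTo suc d ++ applyUpTo (λ j → d + 1 + 2 * j) n) (k + g)) (length-applyUpTo suc d) ⟨
      nth (applyUpTo suc d ++ applyUpTo (λ j → d + 1 + 2 * j) n) (length (applyUpTo suc d) + g)
        ≡⟨ nth-++ʳ (applyUpTo suc d) _ g ⟩
      nth (applyUpTo (λ j → d + 1 + 2 * j) n) g
        ≡⟨ nth-applyUpTo (λ j → d + 1 + 2 * j) g<n ⟩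
      d + 1 + 2 * g ∎
      where open ≡-Reasoning

first-upper-label : ∀ d n → 2 * n ≤ d + n + 2 → n + ((d + n + 2) ∸ 2 * n) ≡ d + 2
first-upper-label d n 2n≤m+2 = begin
  n + ((d + n + 2) ∸ 2 * n)
    ≡⟨ cong₂ (λ a b → n + (a ∸ b)) (top d n) (double n) ⟩
  n + ((n + (d + 2)) ∸ (n + n))
    ≡⟨ cong (n +_) ([m+n]∸[m+o]≡n∸o n (d + 2) n) ⟩
  n + ((d + 2) ∸ n)
    ≡⟨ m+[n∸m]≡n n≤d+2 ⟩
  d + 2 ∎
  where
  open ≡-Reasoning
  top : ∀ d n → d + n + 2 ≡ n + (d + 2)
  top = solve-∀
  double : ∀ n → 2 * n ≡ n + n
  double = solve-∀
  n≤d+2 : n ≤ d + 2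
  n≤d+2 = +-cancelˡ-≤ n n (d + 2) (subst₂ _≤_ (double n) (top d n) 2n≤m+2)

topDown≡rowRegular : ∀ d n → 2 * n ≤ d + n + 2 → ∀ ℓ c → c < rowLen (part₂ (d + n) n) ℓ →
  topDown (part₂ (d + n) n) (ℓ , c) ≡ rowRegular (d + n) n ((d + n + 2) ∸ 2 * n) (ℓ , c)
topDown≡rowRegular d n 2n≤m+2 zero c c<m = [ low , high ]′ (<-≤-connex c d)
  where
  open RowRegularBottom n ((d + n + 2) ∸ 2 * n) d (first-upper-label d n 2n≤m+2)
  low : c < d → topDown (part₂ (d + n) n) (0 , c) ≡ rowRegular (d + n) n ((d + n + 2) ∸ 2 * n) (0 , c)
  low c<d = trans (topDown-bottom-low d n c<d) (sym (rowRegular-bottom-low c<d))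
  high : d ≤ c → topDown (part₂ (d + n) n) (0 , c) ≡ rowRegular (d + n) n ((d + n + 2) ∸ 2 * n) (0 , c)
  high d≤c = subst (λ x → topDown (part₂ (d + n) n) (0 , x) ≡ rowRegular (d + n) n ((d + n + 2) ∸ 2 * n) (0 , x))
    (m+[n∸m]≡n d≤c) (trans (topDown-bottom-high d n g<n) (sym (rowRegular-bottom-high (c ∸ d) g<n)))
    where
    g<n : c ∸ d < n
    g<n = +-cancelˡ-< d (c ∸ d) n (subst (_< d + n) (sym (m+[n∸m]≡n d≤c)) c<m)
topDown≡rowRegular d n 2n≤m+2 (suc zero) c c<n =
  trans (topDown-top d n c<n) (sym (cong (_+ 2 * c) (first-upper-label d n 2n≤m+2)))
topDown≡rowRegular d n 2n≤m+2 (suc (suc ℓ)) c ()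

ℚ-<⇒≱ : ∀ {x y : ℚ} → x ℚ.< y → ¬ (y ℚ.≤ x)
ℚ-<⇒≱ x<y y≤x = ℚₚ.<-irrefl refl (ℚₚ.<-≤-trans x<y y≤x)

toℚᵘ-/ : ∀ a b .{{_ : NonZero b}} → toℚᵘ (ℤ.+ a / b) ℚᵘ.≃ mkℚᵘ (ℤ.+ a) (pred b)
toℚᵘ-/ a (suc b) = ℚₚ.toℚᵘ-fromℚᵘ (mkℚᵘ (ℤ.+ a) b)

/-≤-cross : ∀ a b c e → a * suc e ≤ c * suc b → ℤ.+ a / suc b ℚ.≤ ℤ.+ c / suc e
/-≤-cross a b c e h = ℚₚ.toℚᵘ-cancel-≤
  (ℚᵘₚ.≤-respˡ-≃ (ℚᵘₚ.≃-sym (toℚᵘ-/ a (suc b))) (ℚᵘₚ.≤-respʳ-≃ (ℚᵘₚ.≃-sym (toℚᵘ-/ c (suc e)))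
    (*≤* (subst₂ ℤ._≤_ (pos-* a (suc e)) (pos-* c (suc b)) (+≤+ h)))))

/-<-cross : ∀ a b c e → a * suc e < c * suc b → ℤ.+ a / suc b ℚ.< ℤ.+ c / suc e
/-<-cross a b c e h = ℚₚ.toℚᵘ-cancel-<
  (ℚᵘₚ.<-respˡ-≃ (ℚᵘₚ.≃-sym (toℚᵘ-/ a (suc b))) (ℚᵘₚ.<-respʳ-≃ (ℚᵘₚ.≃-sym (toℚᵘ-/ c (suc e)))
    (*<* (subst₂ ℤ._<_ (pos-* a (suc e)) (pos-* c (suc b)) (+<+ h)))))

/-<-cross⁻ : ∀ a b c e → ℤ.+ a / suc b ℚ.< ℤ.+ c / suc e → a * suc e < c * suc b
/-<-cross⁻ a b c e lt = ≰⇒> (ℚ-<⇒≱ lt ∘′ /-≤-cross c e a b)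

midpoint-/ : ∀ a b c e →
  ((ℤ.+ a / suc b) ℚ.+ (ℤ.+ c / suc e)) ℚ.* ½ ≡ ℤ.+ (a * suc e + c * suc b) / (suc b * suc e * 2)
midpoint-/ a b c e = ℚₚ.toℚᵘ-injective (begin
  toℚᵘ (((ℤ.+ a / suc b) ℚ.+ (ℤ.+ c / suc e)) ℚ.* ½)
    ≈⟨ ℚₚ.toℚᵘ-homo-* ((ℤ.+ a / suc b) ℚ.+ (ℤ.+ c / suc e)) ½ ⟩
  toℚᵘ ((ℤ.+ a / suc b) ℚ.+ (ℤ.+ c / suc e)) ℚᵘ.* toℚᵘ ½
    ≈⟨ ℚᵘₚ.*-congʳ (ℚₚ.toℚᵘ-homo-+ (ℤ.+ a / suc b) (ℤ.+ c / suc e)) ⟩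
  (toℚᵘ (ℤ.+ a / suc b) ℚᵘ.+ toℚᵘ (ℤ.+ c / suc e)) ℚᵘ.* toℚᵘ ½
    ≈⟨ ℚᵘₚ.*-congʳ (ℚᵘₚ.+-cong (toℚᵘ-/ a (suc b)) (toℚᵘ-/ c (suc e))) ⟩
  (mkℚᵘ (ℤ.+ a) b ℚᵘ.+ mkℚᵘ (ℤ.+ c) e) ℚᵘ.* mkℚᵘ (ℤ.+ 1) 1
    ≈⟨ *≡* (cong (ℤ._* ℤ.+ (suc b * suc e * 2)) numerator) ⟩
  mkℚᵘ (ℤ.+ (a * suc e + c * suc b)) (pred (suc b * suc e * 2))
    ≈⟨ toℚᵘ-/ (a * suc e + c * suc b) (suc b * suc e * 2) ⟨
  toℚᵘ (ℤ.+ (a * suc e + c * suc b) / (suc b * suc e * 2)) ∎)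
  where
  open ℚᵘₚ.≃-Reasoning
  numerator : (ℤ.+ a ℤ.* ℤ.+ suc e ℤ.+ ℤ.+ c ℤ.* ℤ.+ suc b) ℤ.* ℤ.+ 1 ≡ ℤ.+ (a * suc e + c * suc b)
  numerator = trans (ℤₚ.*-identityʳ _)
    (trans (cong₂ ℤ._+_ (sym (pos-* a (suc e))) (sym (pos-* c (suc b)))) (sym (pos-+ (a * suc e) (c * suc b))))

1/-antitone : ∀ h h′ → h′ ≤ h → ℤ.+ 1 / suc h ℚ.≤ ℤ.+ 1 / suc h′
1/-antitone h h′ h′≤h = /-≤-cross 1 h 1 h′ (subst₂ _≤_ (sym (*-identityˡ _)) (sym (*-identityˡ _)) (s≤s h′≤h))

-- Triangular 2-partitions

/1-≤-floor : ∀ y k → ℤ.+ k ≡ floor y → ℤ.+ k / 1 ℚ.≤ y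
/1-≤-floor y@(mkℚ num den-1 _) k k≡⌊y⌋ = ℚₚ.toℚᵘ-cancel-≤ (ℚᵘₚ.≤-respˡ-≃ (ℚᵘₚ.≃-sym (toℚᵘ-/ k 1))
  (*≤* (subst₂ ℤ._≤_ (cong (ℤ._* ℤ.+ suc den-1) (sym (trans k≡⌊y⌋ (ℤ.div-pos-is-/ℕ num (suc den-1)))))
                     (sym (ℤₚ.*-identityʳ num))
    (ℤ.[n/ℕd]*d≤n num (suc den-1)))))

<-floor+1 : ∀ y k → ℤ.+ k ≡ floor y → y ℚ.< ℤ.+ suc k / 1
<-floor+1 y@(mkℚ num den-1 _) k k≡⌊y⌋ = ℚₚ.toℚᵘ-cancel-< (ℚᵘₚ.<-respʳ-≃ (ℚᵘₚ.≃-sym (toℚᵘ-/ (suc k) 1))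
  (*<* (subst₂ ℤ._<_ (sym (ℤₚ.*-identityʳ num))
                     (cong (λ z → ℤ.suc z ℤ.* ℤ.+ suc den-1) (sym (trans k≡⌊y⌋ (ℤ.div-pos-is-/ℕ num (suc den-1)))))
    (ℤ.n<s[n/ℕd]*d num (suc den-1)))))

lineHeight : (r s : ℚ) → Positive s → ℕ → ℚ
lineHeight r s s>0 j = r ℚ.- divPos (ℕ→ℚ j ℚ.* r) s s>0

lineHeight-midpoint : ∀ r s s>0 → lineHeight r s s>0 2 ≡ (lineHeight r s s>0 1 ℚ.+ lineHeight r s s>0 3) ℚ.* ½
lineHeight-midpoint r s s>0 =
  solve 2 (λ r z → r :- (con (ℕ→ℚ 2) :* r) :* z := ((r :- (con (ℕ→ℚ 1) :* r) :* z) :+ (r :- (con (ℕ→ℚ 3) :* r) :* z)) :* con ½)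
    refl r ((ℚ.1/ s) {{ℚₚ.pos⇒nonZero s {{s>0}}}})
  where open +-*-Solver

lineHeight-negative : ∀ r s (r>0 : Positive r) s>0 → s ℚ.< ℕ→ℚ 3 → lineHeight r s s>0 3 ℚ.< 0ℚ
lineHeight-negative r s r>0 s>0 s<3 = subst (r ℚ.- t ℚ.<_) (ℚₚ.+-inverseʳ t) (ℚₚ.+-monoˡ-< (ℚ.- t) r<t)
  where
  instance
    s≢0 : ℚ.NonZero s
    s≢0 = ℚₚ.pos⇒nonZero s {{s>0}}
    s≥0 : ℚ.NonNegative s
    s≥0 = ℚₚ.pos⇒nonNeg s {{s>0}}
    r>0′ : Positive r
    r>0′ = r>0
  t : ℚ
  t = divPos (ℕ→ℚ 3 ℚ.* r) s s>0
  t*s : t ℚ.* s ≡ r ℚ.* ℕ→ℚ 3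
  t*s = trans (ℚₚ.*-assoc (ℕ→ℚ 3 ℚ.* r) (ℚ.1/ s) s)
    (trans (cong (ℕ→ℚ 3 ℚ.* r ℚ.*_) (ℚₚ.*-inverseˡ s)) (trans (ℚₚ.*-identityʳ _) (ℚₚ.*-comm (ℕ→ℚ 3) r)))
  r<t : r ℚ.< t
  r<t = ℚₚ.*-cancelʳ-<-nonNeg s (subst (r ℚ.* s ℚ.<_) (sym t*s) (ℚₚ.*-monoʳ-<-pos r s<3))

triangular₂-bound : ∀ {m n} → Triangular (part₂ m n) → 2 * n < m + 2
triangular₂-bound {m} {zero}   _ = ≤-trans (s≤s z≤n) (m≤n+m 2 m)
triangular₂-bound {m} {suc n′} (r , s , r>0 , s>0 , shape) with ℕ→ℚ 2 ℚₚ.≤? s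
... | no 2≰s = contradiction (proj₂ (shape 2 (s≤s z≤n)) (ℚₚ.≰⇒> 2≰s)) λ ()
... | yes 2≤s = subst₂ _<_ (*-comm (suc n′) 2) (total m) (/-<-cross⁻ (suc n′) 0 (suc m * 1 + 1 * 1) 1 chain)
  where
  open ℚₚ.≤-Reasoning
  total : ∀ m → (suc m * 1 + 1 * 1) * 1 ≡ m + 2
  total = solve-∀
  y : ℕ → ℚ
  y = lineHeight r s s>0
  ⌊y₁⌋ : ℤ.+ m ≡ floor (y 1)
  ⌊y₁⌋ = proj₁ (shape 1 (s≤s z≤n)) (ℚₚ.≤-trans (/-≤-cross 1 0 2 0 (s≤s z≤n)) 2≤s)
  ⌊y₂⌋ : ℤ.+ suc n′ ≡ floor (y 2)
  ⌊y₂⌋ = proj₁ (shape 2 (s≤s z≤n)) 2≤s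
  y₃<1 : y 3 ℚ.< 1ℚ
  y₃<1 with ℕ→ℚ 3 ℚₚ.≤? s
  ... | yes 3≤s = <-floor+1 (y 3) 0 (proj₁ (shape 3 (s≤s z≤n)) 3≤s)
  ... | no 3≰s = ℚₚ.<-trans (lineHeight-negative r s r>0 s>0 (ℚₚ.≰⇒> 3≰s)) (ℚₚ.positive⁻¹ 1ℚ)
  chain : ℤ.+ suc n′ / 1 ℚ.< ℤ.+ (suc m * 1 + 1 * 1) / (1 * 1 * 2)
  chain = begin-strict
    ℤ.+ suc n′ / 1                           ≤⟨ /1-≤-floor (y 2) (suc n′) ⌊y₂⌋ ⟩
    y 2                                      ≡⟨ lineHeight-midpoint r s s>0 ⟩
    (y 1 ℚ.+ y 3) ℚ.* ½                      <⟨ ℚₚ.*-monoˡ-<-pos ½ (ℚₚ.+-mono-< (<-floor+1 (y 1) m ⌊y₁⌋) y₃<1) ⟩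
    (ℤ.+ suc m / 1 ℚ.+ ℤ.+ 1 / 1) ℚ.* ½      ≡⟨ midpoint-/ (suc m) 0 1 0 ⟩
    ℤ.+ (suc m * 1 + 1 * 1) / (1 * 1 * 2)    ∎

∈-cells₂⁻ : ∀ {a b x} → x ∈ cells (a ∷ b ∷ []) → (∃ λ k → x ≡ (0 , k) × k < a) ⊎ (∃ λ k → x ≡ (1 , k) × k < b)
∈-cells₂⁻ {a} {b} x∈ with ∈-++⁻ (map (0 ,_) (upTo a)) x∈
... | inj₁ x∈bottom = let k , k∈ , x≡ = ∈-map⁻ (0 ,_) x∈bottom in inj₁ (k , x≡ , ∈-upTo⁻ k∈)
... | inj₂ x∈top with ∈-++⁻ (map (1 ,_) (upTo b)) x∈top
...   | inj₁ x∈top′ = let k , k∈ , x≡ = ∈-map⁻ (1 ,_) x∈top′ in inj₂ (k , x≡ , ∈-upTo⁻ k∈)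
...   | inj₂ ()

∈-cells₂-bottom : ∀ a b {k} → k < a → (0 , k) ∈ cells (a ∷ b ∷ [])
∈-cells₂-bottom a b k<a = ∈-++⁺ˡ (∈-map⁺ (0 ,_) (∈-upTo⁺ k<a))

∈-cells₂-top : ∀ a b {k} → k < b → (1 , k) ∈ cells (a ∷ b ∷ [])
∈-cells₂-top a b k<b = ∈-++⁺ʳ (map (0 ,_) (upTo a)) (∈-++⁺ˡ (∈-map⁺ (1 ,_) (∈-upTo⁺ k<b)))

cells₂-∀ : ∀ {a b} (P : Cell → Set) → (∀ {k} → k < a → P (0 , k)) → (∀ {k} → k < b → P (1 , k)) →
  ∀ {x} → x ∈ cells (a ∷ b ∷ []) → P x
cells₂-∀ {a} {b} P bottom top x∈ with ∈-cells₂⁻ {a} {b} x∈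
... | inj₁ (k , refl , k<a) = bottom k<a
... | inj₂ (k , refl , k<b) = top k<b

countᵇ-cells₂ : (f : Cell → Bool) (a b : ℕ) →
  countᵇ f (cells (a ∷ b ∷ [])) ≡ countᵇ (λ k → f (0 , k)) (upTo a) + countᵇ (λ k → f (1 , k)) (upTo b)
countᵇ-cells₂ f a b = begin
  countᵇ f (map (0 ,_) (upTo a) ++ map (1 ,_) (upTo b) ++ [])
    ≡⟨ countᵇ-++ f (map (0 ,_) (upTo a)) _ ⟩
  countᵇ f (map (0 ,_) (upTo a)) + countᵇ f (map (1 ,_) (upTo b) ++ [])
    ≡⟨ cong₂ _+_ (countᵇ-map f (0 ,_) (upTo a))
         (trans (cong (countᵇ f) (++-identityʳ (map (1 ,_) (upTo b)))) (countᵇ-map f (1 ,_) (upTo b))) ⟩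
  countᵇ (λ k → f (0 , k)) (upTo a) + countᵇ (λ k → f (1 , k)) (upTo b) ∎
  where open ≡-Reasoning

leg₂-bottom-inside : ∀ a b {k} → k < b → leg (a ∷ b ∷ []) (0 , k) ≡ 1
leg₂-bottom-inside a b k<b = if-true (<⇒<ᵇ k<b)

leg₂-bottom-outside : ∀ a b {k} → b ≤ k → leg (a ∷ b ∷ []) (0 , k) ≡ 0
leg₂-bottom-outside a b {k} b≤k = if-false (λ k<ᵇb → <⇒≱ (<ᵇ⇒< k b k<ᵇb) b≤k)

hook-+ : ∀ {x k} → k < x → suc (x ∸ suc k) + k ≡ x
hook-+ {x} {k} k<x = trans (sym (+-suc (x ∸ suc k) k)) (m∸n+n≡m k<x)

hook-≤ : ∀ {x k} → k < x → suc (x ∸ suc k) ≤ x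
hook-≤ {x} {k} k<x = ≤-trans (m≤m+n _ k) (≤-reflexive (hook-+ k<x))

hook-≤-outside : ∀ {d n k} → n ≤ k → k < d + n → suc ((d + n) ∸ suc k) ≤ d
hook-≤-outside {d} {n} {k} n≤k k<m = +-cancelʳ-≤ k _ d (≤-trans (≤-reflexive (hook-+ k<m)) (+-monoʳ-≤ d n≤k))

hook-≥-inside : ∀ {d n k} → k < n → d ≤ (d + n) ∸ suc k
hook-≥-inside {d} {n} {k} k<n = ≤-trans (m≤m+n d (n ∸ suc k)) (≤-reflexive (sym (+-∸-assoc d k<n)))

v⁻-leg : ∀ μ x {ℓ} → leg μ x ≡ ℓ → v⁻ μ x ≡ ℤ.+ ℓ / suc (arm μ x + ℓ)
v⁻-leg μ x refl = refl

v⁺-leg : ∀ μ x {ℓ} → leg μ x ≡ ℓ → v⁺ μ x ≡ ℤ.+ suc ℓ / suc (arm μ x + ℓ)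
v⁺-leg μ x refl = refl

-- Similar cells

midpoint : List ℕ → ℚ
midpoint λ′ = (v⁻max λ′ ℚ.+ v⁺min λ′) ℚ.* ½

-- similarᵇ λ′ μ x unfolds to similarByArmLegᵇ (midpoint λ′) (arm μ x) (leg μ x).
similarByArmLegᵇ : ℚ → ℕ → ℕ → Bool
similarByArmLegᵇ M r ℓ = does (ℤ.+ ℓ / suc (r + ℓ) ℚₚ.<? M) ∧ does (M ℚₚ.≤? ℤ.+ suc ℓ / suc (r + ℓ))

-- a = ⌊1/M⌋, and L bounds the hooks of the cells of leg 1 that get tested.
record Threshold (M : ℚ) (a L : ℕ) : Set where
  field
    unit-below   : ∀ {h} → suc h ≤ a → M ℚ.≤ ℤ.+ 1 / suc h
    unit-above   : ∀ {h} → a < suc h → ℤ.+ 1 / suc h ℚ.< M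
    double-below : ∀ {h} → suc h ≤ L → M ℚ.≤ ℤ.+ 2 / suc h

  similar-leg₀ : ∀ r → T (similarByArmLegᵇ M r 0) ⇔ suc (r + 0) ≤ a
  similar-leg₀ r = mk⇔
    (λ t → ≮⇒≥ λ a<h → ℚ-<⇒≱ (unit-above a<h) (T-does⁻ (M ℚₚ.≤? _) (proj₂ (to T-∧ t))))
    (λ h≤a → from T-∧ (T-does⁺ (_ ℚₚ.<? M) positive , T-does⁺ (M ℚₚ.≤? _) (unit-below h≤a)))
    where
    positive : ℤ.+ 0 / suc (r + 0) ℚ.< M
    positive = ℚₚ.≤-<-trans (/-≤-cross 0 (r + 0) 1 a z≤n) (unit-above ≤-refl)

  similar-leg₁ : ∀ r → suc (r + 1) ≤ L → T (similarByArmLegᵇ M r 1) ⇔ a < suc (r + 1)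
  similar-leg₁ r h≤L = mk⇔
    (λ t → ≰⇒> λ h≤a → ℚ-<⇒≱ (T-does⁻ (_ ℚₚ.<? M) (proj₁ (to T-∧ t))) (unit-below h≤a))
    (λ a<h → from T-∧ (T-does⁺ (_ ℚₚ.<? M) (unit-above a<h) , T-does⁺ (M ℚₚ.≤? _) (double-below h≤L)))

threshold-/ : ∀ N D a L .{{_ : NonZero D}} → N * a ≤ D → D < N * suc a → N * L ≤ 2 * D → Threshold (ℤ.+ N / D) a L
threshold-/ N (suc D) a L N*a≤D D<N*a′ N*L≤2D = record
  { unit-below   = λ {h} h<a → /-≤-cross N D 1 h
      (≤-trans (*-monoʳ-≤ N h<a) (≤-trans N*a≤D (≤-reflexive (sym (*-identityˡ (suc D))))))
  ; unit-above   = λ {h} a<h → /-<-cross 1 h N D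
      (≤-trans (s≤s (≤-reflexive (*-identityˡ (suc D)))) (≤-trans D<N*a′ (*-monoʳ-≤ N a<h)))
  ; double-below = λ {h} h≤L → /-≤-cross N D 2 h (≤-trans (*-monoʳ-≤ N h≤L) N*L≤2D)
  }

module TwoRowSimilarity (λ′ : List ℕ) {a L : ℕ} (threshold : Threshold (midpoint λ′) a L) where

  open Threshold threshold

  private
    M : ℚ
    M = midpoint λ′

  similar-top : ∀ p {q k} → q ≤ a → k < q → T (similarᵇ λ′ (part₂ p q) (1 , k))
  similar-top p {q} {k} q≤a k<q = from (similar-leg₀ (q ∸ suc k)) (≤-trans hook≤q q≤a)
    where
    hook≤q : suc (q ∸ suc k + 0) ≤ q
    hook≤q = ≤-trans (≤-reflexive (cong suc (+-identityʳ _))) (≤-trans (m≤m+n _ k) (≤-reflexive (hook-+ k<q)))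

  similar-bottom-inside : ∀ p q {k} → k < q → k < p → suc p ≤ L →
    T (similarᵇ λ′ (part₂ p q) (0 , k)) ⇔ a + k ≤ p
  similar-bottom-inside p q {k} k<q k<p p<L = mk⇔
    (λ t → ≤-pred (subst (a + k <_) hook (+-monoˡ-< k (to similar (subst similar-with-leg leg≡1 t)))))
    (λ a+k≤p → subst similar-with-leg (sym leg≡1) (from similar (+-cancelʳ-< k a _ (subst (a + k <_) (sym hook) (s≤s a+k≤p)))))
    where
    r : ℕ
    r = p ∸ suc k
    similar-with-leg : ℕ → Set
    similar-with-leg ℓ = T (similarByArmLegᵇ M r ℓ)
    leg≡1 : leg (part₂ p q) (0 , k) ≡ 1
    leg≡1 = leg₂-bottom-inside p q k<q
    hook : suc (r + 1) + k ≡ suc p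
    hook = cong suc (trans (cong (_+ k) (+-comm r 1)) (hook-+ k<p))
    similar : T (similarByArmLegᵇ M r 1) ⇔ a < suc (r + 1)
    similar = similar-leg₁ r (≤-trans (≤-trans (m≤m+n _ k) (≤-reflexive hook)) p<L)

  similar-bottom-outside : ∀ p q {k} → q ≤ k → k < p → T (similarᵇ λ′ (part₂ p q) (0 , k)) ⇔ p ≤ a + k
  similar-bottom-outside p q {k} q≤k k<p = mk⇔
    (λ t → subst (_≤ a + k) hook (+-monoˡ-≤ k (to similar (subst similar-with-leg leg≡0 t))))
    (λ p≤a+k → subst similar-with-leg (sym leg≡0) (from similar (+-cancelʳ-≤ k _ a (subst (_≤ a + k) (sym hook) p≤a+k))))
    where
    r : ℕ
    r = p ∸ suc k
    similar-with-leg : ℕ → Set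
    similar-with-leg ℓ = T (similarByArmLegᵇ M r ℓ)
    leg≡0 : leg (part₂ p q) (0 , k) ≡ 0
    leg≡0 = leg₂-bottom-outside p q q≤k
    hook : suc (r + 0) + k ≡ p
    hook = trans (cong (λ h → suc h + k) (+-identityʳ r)) (hook-+ k<p)
    similar : T (similarByArmLegᵇ M r 0) ⇔ suc (r + 0) ≤ a
    similar = similar-leg₀ r

  sim-split : ∀ p {q} → q ≤ a → sim λ′ (part₂ p q) ≡ countᵇ (λ k → similarᵇ λ′ (part₂ p q) (0 , k)) (upTo p) + q
  sim-split p {q} q≤a = trans (countᵇ-cells₂ (similarᵇ λ′ (part₂ p q)) p q)
    (cong (countᵇ (λ k → similarᵇ λ′ (part₂ p q) (0 , k)) (upTo p) +_)
      (trans (countᵇ-all _ (upTo q) (similar-top p q≤a ∘ ∈-upTo⁻)) (length-upTo q)))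

  sim-below : ∀ p q → q ≤ p → q ≤ a → suc p ≤ L → p < a → sim λ′ (part₂ p q) ≡ p
  sim-below p q q≤p q≤a p<L p<a = begin
    sim λ′ (part₂ p q)
      ≡⟨ sim-split p q≤a ⟩
    countᵇ (λ k → similarᵇ λ′ (part₂ p q) (0 , k)) (upTo p) + q
      ≡⟨ cong (_+ q) (countᵇ-upTo-gap (λ k → similarᵇ λ′ (part₂ p q) (0 , k)) z≤n q≤p (λ ()) dissimilar similar) ⟩
    p ∸ q + q
      ≡⟨ m∸n+n≡m q≤p ⟩
    p ∎
    where
    open ≡-Reasoning
    dissimilar : ∀ {k} → 0 ≤ k → k < q → ¬ T (similarᵇ λ′ (part₂ p q) (0 , k))
    dissimilar {k} _ k<q t = <⇒≱ (<-≤-trans p<a (m≤m+n a k))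
      (to (similar-bottom-inside p q k<q (<-≤-trans k<q q≤p) p<L) t)
    similar : ∀ {k} → q ≤ k → k < p → T (similarᵇ λ′ (part₂ p q) (0 , k))
    similar {k} q≤k k<p = from (similar-bottom-outside p q q≤k k<p) (≤-trans (<⇒≤ p<a) (m≤m+n a k))

  sim-above-P<q : ∀ P q → P < q → q ≤ a + P → q ≤ a → suc (a + P) ≤ L →
    sim λ′ (part₂ (a + P) q) ≡ a + suc (P + P)
  sim-above-P<q P q P<q q≤p q≤a p<L = begin
    sim λ′ μ
      ≡⟨ sim-split (a + P) q≤a ⟩
    countᵇ (λ k → similarᵇ λ′ μ (0 , k)) (upTo (a + P)) + q
      ≡⟨ cong (_+ q) (countᵇ-upTo-gap (λ k → similarᵇ λ′ μ (0 , k)) P<q q≤p first middle last) ⟩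
    suc P + (a + P ∸ q) + q
      ≡⟨ trans (+-assoc (suc P) _ q) (cong (suc P +_) (m∸n+n≡m q≤p)) ⟩
    suc P + (a + P)
      ≡⟨ rearrange a P ⟩
    a + suc (P + P) ∎
    where
    open ≡-Reasoning
    μ : List ℕ
    μ = part₂ (a + P) q
    first : ∀ {k} → k < suc P → T (similarᵇ λ′ μ (0 , k))
    first {k} k≤P = from (similar-bottom-inside (a + P) q k<q (<-≤-trans k<q q≤p) p<L) (+-monoʳ-≤ a (≤-pred k≤P))
      where
      k<q : k < q
      k<q = ≤-<-trans (≤-pred k≤P) P<q
    middle : ∀ {k} → suc P ≤ k → k < q → ¬ T (similarᵇ λ′ μ (0 , k))
    middle {k} P<k k<q t = <⇒≱ (+-monoʳ-< a P<k) (to (similar-bottom-inside (a + P) q k<q (<-≤-trans k<q q≤p) p<L) t)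
    last : ∀ {k} → q ≤ k → k < a + P → T (similarᵇ λ′ μ (0 , k))
    last {k} q≤k k<p = from (similar-bottom-outside (a + P) q q≤k k<p) (+-monoʳ-≤ a (<⇒≤ (<-≤-trans P<q q≤k)))
    rearrange : ∀ a P → suc P + (a + P) ≡ a + suc (P + P)
    rearrange = solve-∀

  sim-above-q≤P : ∀ P q → q ≤ P → q ≤ a → suc (a + P) ≤ L → sim λ′ (part₂ (a + P) q) ≡ a + (q + q)
  sim-above-q≤P P q q≤P q≤a p<L = begin
    sim λ′ μ
      ≡⟨ sim-split (a + P) q≤a ⟩
    countᵇ (λ k → similarᵇ λ′ μ (0 , k)) (upTo (a + P)) + q
      ≡⟨ cong (_+ q) (countᵇ-upTo-gap (λ k → similarᵇ λ′ μ (0 , k)) q≤P (m≤n+m P a) first middle last) ⟩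
    q + (a + P ∸ P) + q
      ≡⟨ cong (λ x → q + x + q) (m+n∸n≡m a P) ⟩
    q + a + q
      ≡⟨ rearrange q a ⟩
    a + (q + q) ∎
    where
    open ≡-Reasoning
    μ : List ℕ
    μ = part₂ (a + P) q
    q≤p : q ≤ a + P
    q≤p = ≤-trans q≤P (m≤n+m P a)
    first : ∀ {k} → k < q → T (similarᵇ λ′ μ (0 , k))
    first {k} k<q = from (similar-bottom-inside (a + P) q k<q (<-≤-trans k<q q≤p) p<L) (+-monoʳ-≤ a (<⇒≤ (<-≤-trans k<q q≤P)))
    middle : ∀ {k} → q ≤ k → k < P → ¬ T (similarᵇ λ′ μ (0 , k))
    middle {k} q≤k k<P t = <⇒≱ (+-monoʳ-< a k<P) (to (similar-bottom-outside (a + P) q q≤k (<-≤-trans k<P (m≤n+m P a))) t)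
    last : ∀ {k} → P ≤ k → k < a + P → T (similarᵇ λ′ μ (0 , k))
    last {k} P≤k k<p = from (similar-bottom-outside (a + P) q (≤-trans q≤P P≤k) k<p) (+-monoʳ-≤ a P≤k)
    rearrange : ∀ q a → q + a + q ≡ a + (q + q)
    rearrange = solve-∀

  sim-above : ∀ P q → q ≤ a + P → q ≤ a → suc (a + P) ≤ L →
    sim λ′ (part₂ (a + P) q) ≡ a + (suc (P + P) ⊓ (q + q))
  sim-above P q q≤p q≤a p<L = [ q≤P , P<q ]′ (≤-<-connex q P)
    where
    q≤P : q ≤ P → sim λ′ (part₂ (a + P) q) ≡ a + (suc (P + P) ⊓ (q + q))
    q≤P q≤P = trans (sim-above-q≤P P q q≤P q≤a p<L)
      (cong (a +_) (sym (m≥n⇒m⊓n≡n (≤-trans (+-mono-≤ q≤P q≤P) (n≤1+n (P + P))))))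
    P<q : P < q → sim λ′ (part₂ (a + P) q) ≡ a + (suc (P + P) ⊓ (q + q))
    P<q P<q = trans (sim-above-P<q P q P<q q≤p q≤a p<L) (cong (a +_) (sym (m≤n⇒m⊓n≡m (+-mono-≤ P<q (<⇒≤ P<q)))))

-- Deficit cells

record DeficitWitness (θ : Tableau) (λ′ μ : List ℕ) (x : Cell) : Set where
  constructor deficit-witness
  field
    inner      : Cell
    outer      : Cell
    inner∈μ    : inner ∈ cells μ
    outer∈λ    : outer ∈ cells λ′
    outer∉μ    : ¬ T (inShapeᵇ μ outer)
    inverted   : θ outer < θ inner
    x≡meet     : x ≡ (proj₁ inner ⊓ proj₁ outer , proj₂ inner ⊓ proj₂ outer)

≡ᶜ-refl : ∀ x → T (x ≡ᶜ x)
≡ᶜ-refl (a , b) = from T-∧ (≡⇒≡ᵇ a a refl , ≡⇒≡ᵇ b b refl)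

≡ᶜ⇒≡ : ∀ x y → T (x ≡ᶜ y) → x ≡ y
≡ᶜ⇒≡ (a , b) (a′ , b′) t = let a≡ , b≡ = to T-∧ t in cong₂ _,_ (≡ᵇ⇒≡ a a′ a≡) (≡ᵇ⇒≡ b b′ b≡)

deficitᵇ-intro : ∀ {θ λ′ μ} (inner outer : Cell) → inner ∈ cells μ → outer ∈ cells λ′ →
  ¬ T (inShapeᵇ μ outer) → θ outer < θ inner →
  T (deficitᵇ θ λ′ μ (proj₁ inner ⊓ proj₁ outer , proj₂ inner ⊓ proj₂ outer))
deficitᵇ-intro {θ} inner outer inner∈ outer∈ outer∉ inverted =
  any-∈ _ inner∈ (any-∈ _ outer∈ (from T-∧ (T-not outer∉ , from T-∧ (<⇒<ᵇ inverted ,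
    ≡ᶜ-refl (proj₁ inner ⊓ proj₁ outer , proj₂ inner ⊓ proj₂ outer)))))

private
  deficit-condition : Tableau → List ℕ → Cell → Cell → Cell → Bool
  deficit-condition θ μ x c₁ c₂ =
    not (inShapeᵇ μ c₂) ∧ (θ c₂ <ᵇ θ c₁) ∧ (x ≡ᶜ (proj₁ c₁ ⊓ proj₁ c₂ , proj₂ c₁ ⊓ proj₂ c₂))

deficitᵇ-elim : ∀ {θ λ′ μ x} → T (deficitᵇ θ λ′ μ x) → DeficitWitness θ λ′ μ x
deficitᵇ-elim {θ} {λ′} {μ} {x} t
  with any-witness (λ c₁ → any (deficit-condition θ μ x c₁) (cells λ′)) (cells μ) t
... | inner , inner∈ , t′ with any-witness (deficit-condition θ μ x inner) (cells λ′) t′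
... | outer , outer∈ , t″ =
  let outer∉ , t‴ = to (T-∧ {not (inShapeᵇ μ outer)}) t″
      inverted , meet = to (T-∧ {θ outer <ᵇ θ inner}) t‴
  in deficit-witness inner outer inner∈ outer∈ (λ inside → ¬T-not inside outer∉)
       (<ᵇ⇒< (θ outer) (θ inner) inverted) (≡ᶜ⇒≡ x _ meet)

module TwoRowDeficit {d n : ℕ} {θ : Tableau} (ordered : TopDownOrdered d n θ) where

  open TopDownOrdered ordered

  private
    λ′ : List ℕ
    λ′ = part₂ (d + n) n

  deficit-inner : ∀ p q {k} → q ≤ p → q ≤ n → k < q → p < d + n → p ≤ d + k → T (deficitᵇ θ λ′ (part₂ p q) (0 , k))
  deficit-inner p q {k} q≤p q≤n k<q p<m p≤d+k =
    subst (T ∘ deficitᵇ θ λ′ (part₂ p q)) (cong (0 ,_) (m≤n⇒m⊓n≡m (<⇒≤ (<-≤-trans k<q q≤p))))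
      (deficitᵇ-intro {θ} {λ′} {part₂ p q} (1 , k) (0 , p) (∈-cells₂-top p q k<q) (∈-cells₂-bottom (d + n) n p<m)
        (λ p<p → <-irrefl refl (<ᵇ⇒< p p p<p)) (bottom-<-top (<-≤-trans k<q q≤n) p≤d+k))

  deficit-outer : ∀ p q {k} → p ≤ d + n → q ≤ k → k < n → suc (d + k) < p → T (deficitᵇ θ λ′ (part₂ p q) (0 , k))
  deficit-outer p q {k} p≤m q≤k k<n d+k<p =
    subst (T ∘ deficitᵇ θ λ′ (part₂ p q)) (cong (0 ,_) (m≥n⇒m⊓n≡n (m≤n+m k (suc d))))
      (deficitᵇ-intro {θ} {λ′} {part₂ p q} (0 , suc (d + k)) (1 , k) (∈-cells₂-bottom p q d+k<p) (∈-cells₂-top (d + n) n k<n)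
        (λ k<q → <⇒≱ (<ᵇ⇒< k q k<q) q≤k) (top-<-bottom (<-≤-trans d+k<p p≤m) (n<1+n (d + k))))

  deficit-top : ∀ p q {k} → ¬ T (deficitᵇ θ λ′ (part₂ p q) (1 , k))
  deficit-top p q {k} t with deficitᵇ-elim {θ} {λ′} {part₂ p q} {1 , k} t
  ... | deficit-witness c₁ c₂ c₁∈ c₂∈ c₂∉ c₂<c₁ meet
    with ∈-cells₂⁻ {p} {q} c₁∈ | ∈-cells₂⁻ {d + n} {n} c₂∈
  ... | inj₁ (_ , refl , _) | _                   = 1+n≢0 (cong proj₁ meet)
  ... | inj₂ (_ , refl , _) | inj₁ (_ , refl , _) = 1+n≢0 (cong proj₁ meet)
  ... | inj₂ (j₁ , refl , j₁<q) | inj₂ (j₂ , refl , j₂<n) =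
    <-asym c₂<c₁ (top-< (<-≤-trans j₁<q (≮⇒≥ (c₂∉ ∘ <⇒<ᵇ))) j₂<n)

  deficit-bottom⁻ : ∀ p q {k} → q ≤ p → T (deficitᵇ θ λ′ (part₂ p q) (0 , k)) →
    (k < q × p < d + n × p ≤ d + k) ⊎ (q ≤ k × k < n × suc (d + k) < p)
  deficit-bottom⁻ p q {k} q≤p t with deficitᵇ-elim {θ} {λ′} {part₂ p q} {0 , k} t
  ... | deficit-witness c₁ c₂ c₁∈ c₂∈ c₂∉ c₂<c₁ meet
    with ∈-cells₂⁻ {p} {q} c₁∈ | ∈-cells₂⁻ {d + n} {n} c₂∈
  ... | inj₁ (j₁ , refl , j₁<p) | inj₁ (j₂ , refl , j₂<m) =
    ⊥-elim (<-asym c₂<c₁ (bottom-< (<-≤-trans j₁<p (≮⇒≥ (c₂∉ ∘ <⇒<ᵇ))) j₂<m))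
  ... | inj₁ (j₁ , refl , j₁<p) | inj₂ (j₂ , refl , j₂<n) =
    inj₂ (subst (q ≤_) (sym k≡j₂) q≤j₂ , subst (_< n) (sym k≡j₂) j₂<n ,
          subst (λ j → suc (d + j) < p) (sym k≡j₂) (≤-<-trans d+j₂<j₁ j₁<p))
    where
    q≤j₂ : q ≤ j₂
    q≤j₂ = ≮⇒≥ (c₂∉ ∘ <⇒<ᵇ)
    d+j₂<j₁ : d + j₂ < j₁
    d+j₂<j₁ = ≰⇒> λ j₁≤d+j₂ → <-asym c₂<c₁ (bottom-<-top j₂<n j₁≤d+j₂)
    k≡j₂ : k ≡ j₂
    k≡j₂ = trans (cong proj₂ meet) (m≥n⇒m⊓n≡n (≤-trans (m≤n+m j₂ d) (<⇒≤ d+j₂<j₁)))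
  ... | inj₂ (j₁ , refl , j₁<q) | inj₁ (j₂ , refl , j₂<m) =
    inj₁ (subst (_< q) (sym k≡j₁) j₁<q , ≤-<-trans p≤j₂ j₂<m ,
          subst (λ j → p ≤ d + j) (sym k≡j₁) (≤-trans p≤j₂ j₂≤d+j₁))
    where
    p≤j₂ : p ≤ j₂
    p≤j₂ = ≮⇒≥ (c₂∉ ∘ <⇒<ᵇ)
    j₂≤d+j₁ : j₂ ≤ d + j₁
    j₂≤d+j₁ = ≮⇒≥ λ d+j₁<j₂ → <-asym c₂<c₁ (top-<-bottom j₂<m d+j₁<j₂)
    k≡j₁ : k ≡ j₁
    k≡j₁ = trans (cong proj₂ meet) (m≤n⇒m⊓n≡m (≤-trans (<⇒≤ j₁<q) (≤-trans q≤p p≤j₂)))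
  ... | inj₂ (_ , refl , _) | inj₂ (_ , refl , _) = ⊥-elim (0≢1+n (cong proj₁ meet))

  private
    non-deficit : ∀ p q {k} → q ≤ p → ¬ (k < q × p < d + n × p ≤ d + k) → ¬ (q ≤ k × k < n × suc (d + k) < p) →
      T (not (deficitᵇ θ λ′ (part₂ p q) (0 , k)))
    non-deficit p q q≤p ¬inner ¬outer = T-not ([ ¬inner , ¬outer ]′ ∘ deficit-bottom⁻ p q q≤p)

  simθ-split : ∀ p {q} → simθ θ λ′ (part₂ p q) ≡ countᵇ (λ k → not (deficitᵇ θ λ′ (part₂ p q) (0 , k))) (upTo p) + q
  simθ-split p {q} = trans (countᵇ-cells₂ (λ x → not (deficitᵇ θ λ′ (part₂ p q) x)) p q)
    (cong (countᵇ (λ k → not (deficitᵇ θ λ′ (part₂ p q) (0 , k))) (upTo p) +_)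
      (trans (countᵇ-all (λ k → not (deficitᵇ θ λ′ (part₂ p q) (1 , k))) (upTo q) (λ {k} _ → T-not (deficit-top p q {k})))
             (length-upTo q)))

  simθ-below : ∀ p q → q ≤ p → q ≤ n → p ≤ d → simθ θ λ′ (part₂ p q) ≡ p
  simθ-below p q q≤p q≤n p≤d = begin
    simθ θ λ′ (part₂ p q)
      ≡⟨ simθ-split p ⟩
    countᵇ (λ k → not (deficitᵇ θ λ′ (part₂ p q) (0 , k))) (upTo p) + q
      ≡⟨ cong (_+ q) (countᵇ-upTo-gap (λ k → not (deficitᵇ θ λ′ (part₂ p q) (0 , k))) z≤n q≤p (λ ()) deficient sound) ⟩
    p ∸ q + q
      ≡⟨ m∸n+n≡m q≤p ⟩
    p ∎
    where
    open ≡-Reasoning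
    deficient : ∀ {k} → 0 ≤ k → k < q → ¬ T (not (deficitᵇ θ λ′ (part₂ p q) (0 , k)))
    deficient {k} _ k<q = ¬T-not (deficit-inner p q q≤p q≤n k<q
      (≤-<-trans p≤d (m<m+n d (≤-<-trans z≤n (<-≤-trans k<q q≤n)))) (≤-trans p≤d (m≤m+n d k)))
    sound : ∀ {k} → q ≤ k → k < p → T (not (deficitᵇ θ λ′ (part₂ p q) (0 , k)))
    sound {k} q≤k k<p = non-deficit p q q≤p (λ (k<q , _) → <⇒≱ k<q q≤k)
      (λ (_ , _ , d+k<p) → <⇒≱ d+k<p (≤-trans p≤d (≤-trans (m≤m+n d k) (n≤1+n _))))

  simθ-above-P≤q : ∀ P q → P ≤ q → q ≤ d + P → q ≤ n → simθ θ λ′ (part₂ (d + P) q) ≡ d + (P + P)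
  simθ-above-P≤q P q P≤q q≤p q≤n = begin
    simθ θ λ′ μ
      ≡⟨ simθ-split (d + P) ⟩
    countᵇ (λ k → not (deficitᵇ θ λ′ μ (0 , k))) (upTo (d + P)) + q
      ≡⟨ cong (_+ q) (countᵇ-upTo-gap (λ k → not (deficitᵇ θ λ′ μ (0 , k))) P≤q q≤p sound₁ deficient sound₂) ⟩
    P + (d + P ∸ q) + q
      ≡⟨ trans (+-assoc P _ q) (cong (P +_) (m∸n+n≡m q≤p)) ⟩
    P + (d + P)
      ≡⟨ rearrange d P ⟩
    d + (P + P) ∎
    where
    open ≡-Reasoning
    μ : List ℕ
    μ = part₂ (d + P) q
    sound₁ : ∀ {k} → k < P → T (not (deficitᵇ θ λ′ μ (0 , k)))
    sound₁ {k} k<P = non-deficit (d + P) q q≤p (λ (_ , _ , p≤d+k) → <⇒≱ k<P (+-cancelˡ-≤ d P k p≤d+k))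
      (λ (q≤k , _) → <⇒≱ (<-≤-trans k<P P≤q) q≤k)
    deficient : ∀ {k} → P ≤ k → k < q → ¬ T (not (deficitᵇ θ λ′ μ (0 , k)))
    deficient {k} P≤k k<q = ¬T-not (deficit-inner (d + P) q q≤p q≤n k<q
      (≤-<-trans (+-monoʳ-≤ d P≤k) (+-monoʳ-< d (<-≤-trans k<q q≤n))) (+-monoʳ-≤ d P≤k))
    sound₂ : ∀ {k} → q ≤ k → k < d + P → T (not (deficitᵇ θ λ′ μ (0 , k)))
    sound₂ {k} q≤k _ = non-deficit (d + P) q q≤p (λ (k<q , _) → <⇒≱ k<q q≤k)
      (λ (_ , _ , d+k<p) → <⇒≱ (+-cancelˡ-< d k P (<-trans (n<1+n (d + k)) d+k<p)) (≤-trans P≤q q≤k))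
    rearrange : ∀ d P → P + (d + P) ≡ d + (P + P)
    rearrange = solve-∀

  simθ-above-q<P : ∀ P′ q → q ≤ P′ → suc P′ ≤ n → simθ θ λ′ (part₂ (d + suc P′) q) ≡ d + suc (q + q)
  simθ-above-q<P P′ q q≤P′ P≤n = begin
    simθ θ λ′ μ
      ≡⟨ simθ-split (d + suc P′) ⟩
    countᵇ (λ k → not (deficitᵇ θ λ′ μ (0 , k))) (upTo (d + suc P′)) + q
      ≡⟨ cong (_+ q) (countᵇ-upTo-gap (λ k → not (deficitᵇ θ λ′ μ (0 , k))) q≤P′ (≤-trans (n≤1+n P′) (m≤n+m (suc P′) d))
           sound₁ deficient sound₂) ⟩
    q + (d + suc P′ ∸ P′) + q
      ≡⟨ cong (λ x → q + x + q) (trans (cong (_∸ P′) (+-suc d P′)) (m+n∸n≡m (suc d) P′)) ⟩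
    q + suc d + q
      ≡⟨ rearrange q d ⟩
    d + suc (q + q) ∎
    where
    open ≡-Reasoning
    μ : List ℕ
    μ = part₂ (d + suc P′) q
    q≤p : q ≤ d + suc P′
    q≤p = ≤-trans (≤-trans q≤P′ (n≤1+n P′)) (m≤n+m (suc P′) d)
    sound₁ : ∀ {k} → k < q → T (not (deficitᵇ θ λ′ μ (0 , k)))
    sound₁ {k} k<q = non-deficit (d + suc P′) q q≤p
      (λ (_ , _ , p≤d+k) → <⇒≱ (<-≤-trans k<q (≤-trans q≤P′ (n≤1+n P′))) (+-cancelˡ-≤ d (suc P′) k p≤d+k))
      (λ (q≤k , _) → <⇒≱ k<q q≤k)
    deficient : ∀ {k} → q ≤ k → k < P′ → ¬ T (not (deficitᵇ θ λ′ μ (0 , k)))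
    deficient {k} q≤k k<P′ = ¬T-not (deficit-outer (d + suc P′) q (+-monoʳ-≤ d P≤n) q≤k
      (<-≤-trans (<-trans k<P′ (n<1+n P′)) P≤n)
      (subst (suc (d + k) <_) (sym (+-suc d P′)) (s≤s (+-monoʳ-< d k<P′))))
    sound₂ : ∀ {k} → P′ ≤ k → k < d + suc P′ → T (not (deficitᵇ θ λ′ μ (0 , k)))
    sound₂ {k} P′≤k _ = non-deficit (d + suc P′) q q≤p (λ (k<q , _) → <⇒≱ (<-≤-trans k<q q≤P′) P′≤k)
      (λ (_ , _ , d+k<p) → <⇒≱ (≤-pred (+-cancelˡ-< d (suc k) (suc P′) (subst (_< d + suc P′) (sym (+-suc d k)) d+k<p))) P′≤k)
    rearrange : ∀ q d → q + suc d + q ≡ d + suc (q + q)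
    rearrange = solve-∀

  simθ-above : ∀ P q → q ≤ d + P → q ≤ n → P ≤ n → simθ θ λ′ (part₂ (d + P) q) ≡ d + ((P + P) ⊓ suc (q + q))
  simθ-above P q q≤p q≤n P≤n = [ P≤q , (λ q<P → q<P′ q<P P≤n) ]′ (≤-<-connex P q)
    where
    P≤q : P ≤ q → simθ θ λ′ (part₂ (d + P) q) ≡ d + ((P + P) ⊓ suc (q + q))
    P≤q P≤q = trans (simθ-above-P≤q P q P≤q q≤p q≤n)
      (cong (d +_) (sym (m≤n⇒m⊓n≡m (≤-trans (+-mono-≤ P≤q P≤q) (n≤1+n (q + q))))))
    q<P′ : ∀ {P} → q < P → P ≤ n → simθ θ λ′ (part₂ (d + P) q) ≡ d + ((P + P) ⊓ suc (q + q))
    q<P′ {suc P′} (s≤s q≤P′) P≤n = trans (simθ-above-q<P P′ q q≤P′ P≤n)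
      (cong (d +_) (sym (m≥n⇒m⊓n≡n (s≤s (+-mono-≤ q≤P′ (≤-trans q≤P′ (n≤1+n P′)))))))

-- Extreme values of v⁻ and v⁺

foldr-⊔-≡ : (f : A → ℚ) {s v : ℚ} (xs : List A) → s ℚ.≤ v → (∀ {x} → x ∈ xs → f x ℚ.≤ v) →
  (∃ λ x → x ∈ xs × f x ≡ v) → foldr ℚ._⊔_ s (map f xs) ≡ v
foldr-⊔-≡ f xs s≤v bounded (x , x∈ , fx≡v) = ℚₚ.≤-antisym (upper xs bounded) (subst (ℚ._≤ _) fx≡v (attained xs x∈))
  where
  upper : ∀ ys → (∀ {x} → x ∈ ys → f x ℚ.≤ _) → foldr ℚ._⊔_ _ (map f ys) ℚ.≤ _
  upper []       _       = s≤v
  upper (y ∷ ys) bounded = ℚₚ.⊔-lub (bounded (here refl)) (upper ys (bounded ∘ there))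
  attained : ∀ {x} ys → x ∈ ys → f x ℚ.≤ foldr ℚ._⊔_ _ (map f ys)
  attained (y ∷ ys) (here refl) = ℚₚ.p≤p⊔q (f y) _
  attained (y ∷ ys) (there x∈)  = ℚₚ.≤-trans (attained ys x∈) (ℚₚ.p≤q⊔p (f y) _)

foldr-⊓-≡ : (f : A → ℚ) {s v : ℚ} (xs : List A) → v ℚ.≤ s → (∀ {x} → x ∈ xs → v ℚ.≤ f x) →
  (∃ λ x → x ∈ xs × f x ≡ v) → foldr ℚ._⊓_ s (map f xs) ≡ v
foldr-⊓-≡ f xs v≤s bounded (x , x∈ , fx≡v) = ℚₚ.≤-antisym (subst (_ ℚ.≤_) fx≡v (attained xs x∈)) (lower xs bounded)
  where
  lower : ∀ ys → (∀ {x} → x ∈ ys → _ ℚ.≤ f x) → _ ℚ.≤ foldr ℚ._⊓_ _ (map f ys)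
  lower []       _       = v≤s
  lower (y ∷ ys) bounded = ℚₚ.⊓-glb (bounded (here refl)) (lower ys (bounded ∘ there))
  attained : ∀ {x} ys → x ∈ ys → foldr ℚ._⊓_ _ (map f ys) ℚ.≤ f x
  attained (y ∷ ys) (here refl) = ℚₚ.p⊓q≤p (f y) _
  attained (y ∷ ys) (there x∈)  = ℚₚ.≤-trans (ℚₚ.p⊓q≤q (f y) _) (attained ys x∈)

v⁻max-two-rows : ∀ d n′ → v⁻max (part₂ (d + suc n′) (suc n′)) ≡ ℤ.+ 1 / suc (suc d)
v⁻max-two-rows d n′ = foldr-⊔-≡ (v⁻ λ′) (cells λ′) (/-≤-cross 0 0 1 (suc d) z≤n)
  (cells₂-∀ (λ x → v⁻ λ′ x ℚ.≤ ℤ.+ 1 / suc (suc d)) bottom (λ {k} _ → /-≤-cross 0 (suc n′ ∸ suc k + 0) 1 (suc d) z≤n))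
  ((0 , n′) , ∈-cells₂-bottom (d + suc n′) (suc n′) (≤-trans (n<1+n n′) (m≤n+m (suc n′) d)) , witness)
  where
  λ′ : List ℕ
  λ′ = part₂ (d + suc n′) (suc n′)
  bottom : ∀ {k} → k < d + suc n′ → v⁻ λ′ (0 , k) ℚ.≤ ℤ.+ 1 / suc (suc d)
  bottom {k} _ with k <? suc n′
  ... | yes k<n = subst (ℚ._≤ _) (sym (v⁻-leg λ′ (0 , k) (leg₂-bottom-inside (d + suc n′) (suc n′) k<n)))
                    (1/-antitone ((d + suc n′) ∸ suc k + 1) (suc d)
                      (≤-trans (≤-reflexive (+-comm 1 d)) (+-monoˡ-≤ 1 (hook-≥-inside k<n))))
  ... | no k≮n = subst (ℚ._≤ _) (sym (v⁻-leg λ′ (0 , k) (leg₂-bottom-outside (d + suc n′) (suc n′) (≮⇒≥ k≮n))))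
                   (/-≤-cross 0 ((d + suc n′) ∸ suc k + 0) 1 (suc d) z≤n)
  witness : v⁻ λ′ (0 , n′) ≡ ℤ.+ 1 / suc (suc d)
  witness = trans (v⁻-leg λ′ (0 , n′) (leg₂-bottom-inside (d + suc n′) (suc n′) (n<1+n n′)))
    (cong (λ h → ℤ.+ 1 / suc h) (trans (cong (_+ 1) (m+n∸n≡m d (suc n′))) (+-comm d 1)))

v⁻max-one-row : ∀ d′ → v⁻max (part₂ (suc d′ + 0) 0) ≡ 0ℚ
v⁻max-one-row d′ = foldr-⊔-≡ (v⁻ λ′) (cells λ′) ℚₚ.≤-refl
  (cells₂-∀ (λ x → v⁻ λ′ x ℚ.≤ 0ℚ) bottom (λ ()))
  ((0 , 0) , ∈-cells₂-bottom (suc d′ + 0) 0 z<s , ℚₚ.0/n≡0 (suc ((suc d′ + 0) ∸ 1 + 0)))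
  where
  λ′ : List ℕ
  λ′ = part₂ (suc d′ + 0) 0
  bottom : ∀ {k} → k < suc d′ + 0 → v⁻ λ′ (0 , k) ℚ.≤ 0ℚ
  bottom {k} _ = subst (ℚ._≤ 0ℚ) (sym (v⁻-leg λ′ (0 , k) (leg₂-bottom-outside (suc d′ + 0) 0 {k} z≤n)))
    (/-≤-cross 0 ((suc d′ + 0) ∸ suc k + 0) 0 0 z≤n)

v⁺min-one-row : ∀ d′ → v⁺min (part₂ (suc d′ + 0) 0) ≡ ℤ.+ 1 / suc d′
v⁺min-one-row d′ = foldr-⊓-≡ (v⁺ λ′) (cells λ′) (1/-antitone d′ 0 z≤n)
  (cells₂-∀ (λ x → ℤ.+ 1 / suc d′ ℚ.≤ v⁺ λ′ x) bottom (λ ()))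
  ((0 , 0) , ∈-cells₂-bottom (suc d′ + 0) 0 z<s , cong (λ h → ℤ.+ 1 / suc h) (trans (+-identityʳ (d′ + 0)) (+-identityʳ d′)))
  where
  λ′ : List ℕ
  λ′ = part₂ (suc d′ + 0) 0
  bottom : ∀ {k} → k < suc d′ + 0 → ℤ.+ 1 / suc d′ ℚ.≤ v⁺ λ′ (0 , k)
  bottom {k} k<d = subst (_ ℚ.≤_) (sym (v⁺-leg λ′ (0 , k) (leg₂-bottom-outside (suc d′ + 0) 0 {k} z≤n)))
    (1/-antitone d′ ((suc d′ + 0) ∸ suc k + 0)
      (≤-pred (≤-trans (s≤s (≤-reflexive (+-identityʳ _))) (≤-trans (hook-≤ k<d) (≤-reflexive (+-identityʳ (suc d′)))))))

v⁺min-wide : ∀ d′ n′ → suc (suc n′) ≤ suc d′ → v⁺min (part₂ (suc d′ + suc n′) (suc n′)) ≡ ℤ.+ 1 / suc d′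
v⁺min-wide d′ n′ n<d = foldr-⊓-≡ (v⁺ λ′) (cells λ′) (1/-antitone d′ 0 z≤n)
  (cells₂-∀ (λ x → ℤ.+ 1 / suc d′ ℚ.≤ v⁺ λ′ x) bottom top)
  ((0 , n) , ∈-cells₂-bottom (d + n) n (m<n+m n z<s) , witness)
  where
  d n : ℕ
  d = suc d′
  n = suc n′
  λ′ : List ℕ
  λ′ = part₂ (d + n) n
  top : ∀ {k} → k < n → ℤ.+ 1 / suc d′ ℚ.≤ v⁺ λ′ (1 , k)
  top {k} k<n = 1/-antitone d′ (n ∸ suc k + 0)
    (≤-trans (≤-reflexive (+-identityʳ _)) (≤-trans (n≤1+n _) (≤-trans (hook-≤ k<n) (≤-pred n<d))))
  bottom : ∀ {k} → k < d + n → ℤ.+ 1 / suc d′ ℚ.≤ v⁺ λ′ (0 , k)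
  bottom {k} k<m with k <? n
  ... | yes k<n = subst (_ ℚ.≤_) (sym (v⁺-leg λ′ (0 , k) (leg₂-bottom-inside (d + n) n k<n)))
    (/-≤-cross 1 d′ 2 ((d + n) ∸ suc k + 1) (subst₂ _≤_ (sym (*-identityˡ (suc ((d + n) ∸ suc k + 1)))) (double d′)
      (≤-trans (s≤s (≤-trans (≤-reflexive (+-comm _ 1)) (hook-≤ k<m)))
               (≤-trans (≤-reflexive (sym (+-suc d n))) (+-monoʳ-≤ d n<d)))))
    where
    double : ∀ d′ → suc d′ + suc d′ ≡ 2 * suc d′
    double = solve-∀
  ... | no k≮n = subst (_ ℚ.≤_) (sym (v⁺-leg λ′ (0 , k) (leg₂-bottom-outside (d + n) n (≮⇒≥ k≮n))))
    (1/-antitone d′ ((d + n) ∸ suc k + 0)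
      (≤-pred (≤-trans (s≤s (≤-reflexive (+-identityʳ _))) (hook-≤-outside (≮⇒≥ k≮n) k<m))))
  witness : v⁺ λ′ (0 , n) ≡ ℤ.+ 1 / suc d′
  witness = trans (v⁺-leg λ′ (0 , n) (leg₂-bottom-outside (d + n) n {n} ≤-refl))
    (cong (λ h → ℤ.+ 1 / suc h) (trans (+-identityʳ _) (trans (sym (pred[m∸n]≡m∸[1+n] (d + n) n)) (cong pred (m+n∸n≡m d n)))))

v⁺min-narrow : ∀ d n′ → d ≤ suc n′ → suc n′ ≤ suc d → v⁺min (part₂ (d + suc n′) (suc n′)) ≡ ℤ.+ 2 / suc (d + suc n′)
v⁺min-narrow d n′ d≤n n≤1+d = foldr-⊓-≡ (v⁺ λ′) (cells λ′)
  (/-≤-cross 2 (d + n) 1 0 (subst (2 ≤_) (sym (*-identityˡ (suc (d + n)))) (s≤s 1≤m)))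
  (cells₂-∀ (λ x → ℤ.+ 2 / suc (d + n) ℚ.≤ v⁺ λ′ x) bottom top)
  ((0 , 0) , ∈-cells₂-bottom (d + n) n 1≤m , witness)
  where
  n : ℕ
  n = suc n′
  λ′ : List ℕ
  λ′ = part₂ (d + n) n
  1≤m : 1 ≤ d + n
  1≤m = ≤-trans (s≤s z≤n) (m≤n+m n d)
  2n≤m+1 : n + n ≤ suc (d + n)
  2n≤m+1 = +-monoˡ-≤ n n≤1+d
  top : ∀ {k} → k < n → ℤ.+ 2 / suc (d + n) ℚ.≤ v⁺ λ′ (1 , k)
  top {k} k<n = /-≤-cross 2 (d + n) 1 (n ∸ suc k + 0) (subst₂ _≤_ (double (suc (n ∸ suc k + 0))) (sym (*-identityˡ (suc (d + n))))
    (≤-trans (+-mono-≤ h≤n h≤n) 2n≤m+1))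
    where
    h≤n : suc (n ∸ suc k + 0) ≤ n
    h≤n = ≤-trans (s≤s (≤-reflexive (+-identityʳ _))) (hook-≤ k<n)
    double : ∀ h → h + h ≡ 2 * h
    double = solve-∀
  bottom : ∀ {k} → k < d + n → ℤ.+ 2 / suc (d + n) ℚ.≤ v⁺ λ′ (0 , k)
  bottom {k} k<m with k <? n
  ... | yes k<n = subst (_ ℚ.≤_) (sym (v⁺-leg λ′ (0 , k) (leg₂-bottom-inside (d + n) n k<n)))
    (/-≤-cross 2 (d + n) 2 ((d + n) ∸ suc k + 1) (*-monoʳ-≤ 2 (s≤s (≤-trans (≤-reflexive (+-comm _ 1)) (hook-≤ k<m)))))
  ... | no k≮n = subst (_ ℚ.≤_) (sym (v⁺-leg λ′ (0 , k) (leg₂-bottom-outside (d + n) n (≮⇒≥ k≮n))))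
    (/-≤-cross 2 (d + n) 1 ((d + n) ∸ suc k + 0) (subst₂ _≤_ (double (suc ((d + n) ∸ suc k + 0))) (sym (*-identityˡ (suc (d + n))))
      (≤-trans (+-mono-≤ h≤d h≤d) (≤-trans (+-monoʳ-≤ d d≤n) (n≤1+n (d + n))))))
    where
    h≤d : suc ((d + n) ∸ suc k + 0) ≤ d
    h≤d = ≤-trans (s≤s (≤-reflexive (+-identityʳ _))) (hook-≤-outside (≮⇒≥ k≮n) k<m)
    double : ∀ h → h + h ≡ 2 * h
    double = solve-∀
  witness : v⁺ λ′ (0 , 0) ≡ ℤ.+ 2 / suc (d + n)
  witness = cong (λ h → ℤ.+ 2 / suc h) (trans (+-comm _ 1) (m+[n∸m]≡n 1≤m))

midpoint-two-rows : ∀ λ′ α α′ β β′ → v⁻max λ′ ≡ ℤ.+ α / suc α′ → v⁺min λ′ ≡ ℤ.+ β / suc β′ →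
  midpoint λ′ ≡ ℤ.+ (α * suc β′ + β * suc α′) / (suc α′ * suc β′ * 2)
midpoint-two-rows λ′ α α′ β β′ v⁻≡ v⁺≡ =
  trans (cong₂ (λ x y → (x ℚ.+ y) ℚ.* ½) v⁻≡ v⁺≡) (midpoint-/ α α′ β β′)

-- Coefficients of the generating functions

subpartitionRow : ℕ → ℕ → List (List ℕ)
subpartitionRow n p = map (λ q → part₂ p q) (upTo (suc (p ⊓ n)))

∈-subpartitionRows⁻ : ∀ {n μ} xs → μ ∈ concatMap (subpartitionRow n) xs →
  ∃₂ λ p q → μ ≡ part₂ p q × p ∈ xs × q ≤ p × q ≤ n
∈-subpartitionRows⁻ {n} xs μ∈ =
  let p , p∈ , μ∈row = find (∈-concatMap⁻ (subpartitionRow n) {xs = xs} μ∈)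
      q , q∈ , μ≡ = ∈-map⁻ (λ q → part₂ p q) μ∈row
      q≤p⊓n = ≤-pred (∈-upTo⁻ q∈)
  in p , q , μ≡ , p∈ , ≤-trans q≤p⊓n (m⊓n≤m p n) , ≤-trans q≤p⊓n (m⊓n≤n p n)

matchesᵇ : ℕ → ℕ → ℕ × ℕ → Bool
matchesᵇ a b e = (proj₁ e ≡ᵇ a) ∧ (proj₂ e ≡ᵇ b)

coeff-map : ∀ (F : A → ℕ × ℕ) xs a b → coeff (map F xs) a b ≡ countᵇ (matchesᵇ a b ∘ F) xs
coeff-map F xs a b = countᵇ-map (matchesᵇ a b) F xs

coeff-pointwise : ∀ {m n} (F G : List ℕ → ℕ × ℕ) →
  (∀ {p q} → p ≤ m → q ≤ p → q ≤ n → F (part₂ p q) ≡ G (part₂ p q)) →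
  ∀ a b → coeff (map F (subpartitions₂ m n)) a b ≡ coeff (map G (subpartitions₂ m n)) a b
coeff-pointwise {m} {n} F G F≗G a b = begin
  coeff (map F (subpartitions₂ m n)) a b        ≡⟨ coeff-map F (subpartitions₂ m n) a b ⟩
  countᵇ (matchesᵇ a b ∘ F) (subpartitions₂ m n) ≡⟨ countᵇ-cong _ _ (subpartitions₂ m n) agree ⟩
  countᵇ (matchesᵇ a b ∘ G) (subpartitions₂ m n) ≡⟨ coeff-map G (subpartitions₂ m n) a b ⟨
  coeff (map G (subpartitions₂ m n)) a b        ∎
  where
  open ≡-Reasoning
  agree : ∀ {μ} → μ ∈ subpartitions₂ m n → matchesᵇ a b (F μ) ≡ matchesᵇ a b (G μ)
  agree μ∈ with ∈-subpartitionRows⁻ (upTo (suc m)) μ∈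
  ... | p , q , refl , p∈ , q≤p , q≤n = cong (matchesᵇ a b) (F≗G (≤-pred (∈-upTo⁻ p∈)) q≤p q≤n)

coeff-transpose : ∀ {d n} (F G : List ℕ → ℕ × ℕ) → n ≤ d →
  (∀ {p q} → p < d → q ≤ p → q ≤ n → F (part₂ p q) ≡ G (part₂ p q)) →
  (∀ {P q} → P ≤ n → q ≤ n → F (part₂ (d + P) q) ≡ G (part₂ (d + q) P)) →
  ∀ a b → coeff (map F (subpartitions₂ (d + n) n)) a b ≡ coeff (map G (subpartitions₂ (d + n) n)) a b
coeff-transpose {d} {n} F G n≤d low square a b = begin
  coeff (map F (subpartitions₂ (d + n) n)) a b
    ≡⟨ split F ⟩
  countᵇ (matches F) narrow + countᵇ (matches F) wide
    ≡⟨ cong₂ _+_ (countᵇ-cong (matches F) (matches G) narrow agree) (grid F) ⟩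
  countᵇ (matches G) narrow + ∑[ P < suc n ] ∑[ q < suc n ] indicator F (d + toℕ P) (toℕ q)
    ≡⟨ cong (countᵇ (matches G) narrow +_) (sum-cong-≗ λ P → sum-cong-≗ λ q →
         cong (λ e → countᵇ (matchesᵇ a b) [ e ]) (square (≤-pred (toℕ<n P)) (≤-pred (toℕ<n q)))) ⟩
  countᵇ (matches G) narrow + ∑[ P < suc n ] ∑[ q < suc n ] indicator G (d + toℕ q) (toℕ P)
    ≡⟨ cong (countᵇ (matches G) narrow +_) (∑-comm {suc n} {suc n} (λ P q → indicator G (d + toℕ q) (toℕ P))) ⟩
  countᵇ (matches G) narrow + ∑[ q < suc n ] ∑[ P < suc n ] indicator G (d + toℕ q) (toℕ P)
    ≡⟨ cong (countᵇ (matches G) narrow +_) (grid G) ⟨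
  countᵇ (matches G) narrow + countᵇ (matches G) wide
    ≡⟨ split G ⟨
  coeff (map G (subpartitions₂ (d + n) n)) a b ∎
  where
  open ≡-Reasoning
  matches : (List ℕ → ℕ × ℕ) → List ℕ → Bool
  matches H = matchesᵇ a b ∘ H
  indicator : (List ℕ → ℕ × ℕ) → ℕ → ℕ → ℕ
  indicator H p q = countᵇ (matches H) [ part₂ p q ]
  narrow wide : List (List ℕ)
  narrow = concatMap (subpartitionRow n) (upTo d)
  wide   = concatMap (subpartitionRow n) (applyUpTo (d +_) (suc n))
  split : ∀ H → coeff (map H (subpartitions₂ (d + n) n)) a b ≡ countᵇ (matches H) narrow + countᵇ (matches H) wide
  split H = begin
    coeff (map H (subpartitions₂ (d + n) n)) a b
      ≡⟨ coeff-map H (subpartitions₂ (d + n) n) a b ⟩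
    countᵇ (matches H) (concatMap (subpartitionRow n) (upTo (suc (d + n))))
      ≡⟨ cong (countᵇ (matches H) ∘ concatMap (subpartitionRow n)) (trans (cong upTo (sym (+-suc d n))) (applyUpTo-+ id d (suc n))) ⟩
    countᵇ (matches H) (concatMap (subpartitionRow n) (upTo d ++ applyUpTo (d +_) (suc n)))
      ≡⟨ cong (countᵇ (matches H)) (concatMap-++ (subpartitionRow n) (upTo d) (applyUpTo (d +_) (suc n))) ⟩
    countᵇ (matches H) (narrow ++ wide)
      ≡⟨ countᵇ-++ (matches H) narrow wide ⟩
    countᵇ (matches H) narrow + countᵇ (matches H) wide ∎
  row : ∀ H P → countᵇ (matches H) (subpartitionRow n (d + P)) ≡ ∑[ q < suc n ] indicator H (d + P) (toℕ q)
  row H P = begin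
    countᵇ (matches H) (map (part₂ (d + P)) (upTo (suc ((d + P) ⊓ n))))
      ≡⟨ cong (λ k → countᵇ (matches H) (map (part₂ (d + P)) (upTo (suc k)))) (m≥n⇒m⊓n≡n (≤-trans n≤d (m≤m+n d P))) ⟩
    countᵇ (matches H) (map (part₂ (d + P)) (upTo (suc n)))
      ≡⟨ cong (countᵇ (matches H)) (map-upTo (part₂ (d + P)) (suc n)) ⟩
    countᵇ (matches H) (applyUpTo (part₂ (d + P)) (suc n))
      ≡⟨ countᵇ-applyUpTo (matches H) (part₂ (d + P)) (suc n) ⟩
    ∑[ q < suc n ] indicator H (d + P) (toℕ q) ∎
  grid : ∀ H → countᵇ (matches H) wide ≡ ∑[ P < suc n ] ∑[ q < suc n ] indicator H (d + toℕ P) (toℕ q)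
  grid H = trans (countᵇ-concatMap-applyUpTo (matches H) (subpartitionRow n) (d +_) (suc n)) (sum-cong-≗ {suc n} (row H ∘ toℕ))
  agree : ∀ {μ} → μ ∈ narrow → matches F μ ≡ matches G μ
  agree μ∈ with ∈-subpartitionRows⁻ (upTo d) μ∈
  ... | p , q , refl , p∈ , q≤p , q≤n = cong (matchesᵇ a b) (low (∈-upTo⁻ p∈) q≤p q≤n)

-- Sim-symmetry of the top-down tableau

≤-by : ∀ {x y} z → y ≡ x + z → x ≤ y
≤-by {x} z y≡ = ≤-trans (m≤m+n x z) (≤-reflexive (sym y≡))

<-by : ∀ {x y} z → y ≡ suc (x + z) → x < y
<-by {x} z y≡ = ≤-trans (s≤s (m≤m+n x z)) (≤-reflexive (sym y≡))

sim-sym-one-row : ∀ d′ → SimSym₂ (suc d′ + 0) 0 (topDown (part₂ (suc d′ + 0) 0))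
sim-sym-one-row d′ = coeff-pointwise (λ μ → area λ′ μ , simθ θ λ′ μ) (λ μ → area λ′ μ , sim λ′ μ)
  λ {p} {q} p≤m q≤p q≤0 → cong (area λ′ (part₂ p q) ,_)
    (trans (simθ-below p q q≤p q≤0 (≤-trans p≤m (≤-reflexive (+-identityʳ (suc d′)))))
      (sym (sim-below p q q≤p (≤-trans q≤0 z≤n) (s≤s p≤m) (≤-<-trans p≤m m<a))))
  where
  λ′ : List ℕ
  λ′ = part₂ (suc d′ + 0) 0
  θ : Tableau
  θ = topDown λ′
  a : ℕ
  a = 1 * suc d′ * 2
  open TwoRowDeficit (topDown-ordered (suc d′) 0)
  m<a : suc d′ + 0 < a
  m<a = <-by d′ (identity d′)
    where
    identity : ∀ d′ → 1 * suc d′ * 2 ≡ suc (suc d′ + 0 + d′)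
    identity = solve-∀
  threshold : Threshold (midpoint λ′) a (suc (suc d′ + 0))
  threshold = subst (λ M → Threshold M a (suc (suc d′ + 0)))
    (sym (midpoint-two-rows λ′ 0 0 1 d′ (v⁻max-one-row d′) (v⁺min-one-row d′)))
    (threshold-/ 1 a a (suc (suc d′ + 0)) (≤-reflexive (*-identityˡ a)) (≤-reflexive (sym (*-identityˡ (suc a))))
      (≤-by (3 * d′ + 2) (identity d′)))
    where
    identity : ∀ d′ → 2 * (1 * suc d′ * 2) ≡ 1 * suc (suc d′ + 0) + (3 * d′ + 2)
    identity = solve-∀
  open TwoRowSimilarity λ′ threshold

sim-sym-wide : ∀ d n′ → suc n′ < d → SimSym₂ (d + suc n′) (suc n′) (topDown (part₂ (d + suc n′) (suc n′)))
sim-sym-wide (suc d′) n′ n<d = coeff-transpose (λ μ → area λ′ μ , simθ θ λ′ μ) (λ μ → area λ′ μ , sim λ′ μ)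
  (≤-trans (n≤1+n n) n<d)
  (λ {p} {q} p<d q≤p q≤n → cong (area λ′ (part₂ p q) ,_)
    (trans (simθ-below p q q≤p q≤n (<⇒≤ p<d)) (sym (sim-below p q q≤p (q≤d q≤n) (s≤s (≤-trans (<⇒≤ p<d) (m≤m+n d n))) p<d))))
  (λ {P} {q} P≤n q≤n → cong₂ _,_ (cong (size λ′ ∸_) (swap d P q))
    (begin
      simθ θ λ′ (part₂ (d + P) q)   ≡⟨ simθ-above P q (≤-trans (q≤d q≤n) (m≤m+n d P)) q≤n P≤n ⟩
      d + ((P + P) ⊓ suc (q + q))    ≡⟨ cong (d +_) (⊓-comm (P + P) (suc (q + q))) ⟩
      d + (suc (q + q) ⊓ (P + P))    ≡⟨ sim-above q P (≤-trans (q≤d P≤n) (m≤m+n d q)) (q≤d P≤n) (s≤s (+-monoʳ-≤ d q≤n)) ⟨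
      sim λ′ (part₂ (d + q) P)       ∎))
  where
  open ≡-Reasoning
  d n : ℕ
  d = suc d′
  n = suc n′
  λ′ : List ℕ
  λ′ = part₂ (d + n) n
  θ : Tableau
  θ = topDown λ′
  open TwoRowDeficit (topDown-ordered d n)
  q≤d : ∀ {q} → q ≤ n → q ≤ d
  q≤d q≤n = ≤-trans q≤n (≤-trans (n≤1+n n) n<d)
  swap : ∀ d P q → d + P + (q + 0) ≡ d + q + (P + 0)
  swap = solve-∀
  N D : ℕ
  N = 1 * suc d′ + 1 * suc (suc d)
  D = suc (suc d) * suc d′ * 2
  threshold : Threshold (midpoint λ′) d (suc (d + n))
  threshold = subst (λ M → Threshold M d (suc (d + n)))
    (sym (midpoint-two-rows λ′ 1 (suc d) 1 d′ (v⁻max-two-rows d n′) (v⁺min-wide d′ n′ n<d)))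
    (threshold-/ N D d (suc (d + n)) (≤-by (2 * d) (below d′)) (<-by 1 (above d′))
      (≤-trans (*-monoʳ-≤ N (≤-trans (≤-reflexive (sym (+-suc d n))) (+-monoʳ-≤ d n<d))) (≤-by (4 * d) (double d′))))
    where
    below : ∀ d′ → suc (suc (suc d′)) * suc d′ * 2 ≡ (1 * suc d′ + 1 * suc (suc (suc d′))) * suc d′ + 2 * suc d′
    below = solve-∀
    above : ∀ d′ → (1 * suc d′ + 1 * suc (suc (suc d′))) * suc (suc d′) ≡ suc (suc (suc (suc d′)) * suc d′ * 2 + 1)
    above = solve-∀
    double : ∀ d′ → 2 * (suc (suc (suc d′)) * suc d′ * 2)
                  ≡ (1 * suc d′ + 1 * suc (suc (suc d′))) * (suc d′ + suc d′) + 4 * suc d′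
    double = solve-∀
  open TwoRowSimilarity λ′ threshold

narrow-bounds : ∀ d n′ → d ≤ suc n′ → suc n′ ≤ suc d →
  let n = suc n′
      N = 1 * suc (d + n) + 2 * suc (suc d)
      D = suc (suc d) * suc (d + n) * 2
  in N * suc d ≤ D × D < N * suc (suc d) × N * suc (d + n) ≤ 2 * D
narrow-bounds d n′ d≤n n≤1+d with m≤n⇒m<n∨m≡n d≤n
... | inj₁ d<n rewrite ≤-antisym n≤1+d d<n =
  ≤-by (2 * d + 2) (below d) , <-by (2 * d + 3) (above d) , ≤-by (4 * d + 4) (double d)
  where
  below : ∀ d → suc (suc d) * suc (d + suc d) * 2 ≡ (1 * suc (d + suc d) + 2 * suc (suc d)) * suc d + (2 * d + 2)
  below = solve-∀
  above : ∀ d → (1 * suc (d + suc d) + 2 * suc (suc d)) * suc (suc d) ≡ suc (suc (suc d) * suc (d + suc d) * 2 + (2 * d + 3))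
  above = solve-∀
  double : ∀ d → 2 * (suc (suc d) * suc (d + suc d) * 2) ≡ (1 * suc (d + suc d) + 2 * suc (suc d)) * suc (d + suc d) + (4 * d + 4)
  double = solve-∀
narrow-bounds _ e _ _ | inj₂ refl =
  ≤-by e (below e) , <-by (3 * e + 8) (above e) , ≤-by (6 * e + 9) (double e)
  where
  below : ∀ e → suc (suc (suc e)) * suc (suc e + suc e) * 2 ≡ (1 * suc (suc e + suc e) + 2 * suc (suc (suc e))) * suc (suc e) + e
  below = solve-∀
  above : ∀ e → (1 * suc (suc e + suc e) + 2 * suc (suc (suc e))) * suc (suc (suc e))
              ≡ suc (suc (suc (suc e)) * suc (suc e + suc e) * 2 + (3 * e + 8))
  above = solve-∀
  double : ∀ e → 2 * (suc (suc (suc e)) * suc (suc e + suc e) * 2)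
               ≡ (1 * suc (suc e + suc e) + 2 * suc (suc (suc e))) * suc (suc e + suc e) + (6 * e + 9)
  double = solve-∀

sim-sym-narrow : ∀ d n′ → d ≤ suc n′ → suc n′ ≤ suc d → SimSym₂ (d + suc n′) (suc n′) (topDown (part₂ (d + suc n′) (suc n′)))
sim-sym-narrow d n′ d≤n n≤1+d =
  coeff-pointwise (λ μ → area λ′ μ , simθ θ λ′ μ) (λ μ → area λ′ μ , sim λ′ μ)
    λ {p} {q} p≤m q≤p q≤n → cong (area λ′ (part₂ p q) ,_) (statistic p q p≤m q≤p q≤n)
  where
  n : ℕ
  n = suc n′
  λ′ : List ℕ
  λ′ = part₂ (d + n) n
  θ : Tableau
  θ = topDown λ′
  open TwoRowDeficit (topDown-ordered d n)
  threshold : Threshold (midpoint λ′) (suc d) (suc (d + n))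
  threshold = subst (λ M → Threshold M (suc d) (suc (d + n)))
    (sym (midpoint-two-rows λ′ 1 (suc d) 2 (d + n) (v⁻max-two-rows d n′) (v⁺min-narrow d n′ d≤n n≤1+d)))
    (let below , above , double = narrow-bounds d n′ d≤n n≤1+d
     in threshold-/ (1 * suc (d + n) + 2 * suc (suc d)) (suc (suc d) * suc (d + n) * 2) (suc d) (suc (d + n)) below above double)
  open TwoRowSimilarity λ′ threshold
  q≤a : ∀ {q} → q ≤ n → q ≤ suc d
  q≤a q≤n = ≤-trans q≤n n≤1+d
  statistic-beyond : ∀ P′ q → suc d + P′ ≤ d + n → q ≤ suc d + P′ → q ≤ n →
    simθ θ λ′ (part₂ (suc d + P′) q) ≡ sim λ′ (part₂ (suc d + P′) q)
  statistic-beyond P′ q p≤m q≤p q≤n = begin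
    simθ θ λ′ (part₂ (suc d + P′) q)
      ≡⟨ cong (λ p → simθ θ λ′ (part₂ p q)) (sym (+-suc d P′)) ⟩
    simθ θ λ′ (part₂ (d + suc P′) q)
      ≡⟨ simθ-above (suc P′) q (subst (q ≤_) (sym (+-suc d P′)) q≤p) q≤n
           (+-cancelˡ-≤ d (suc P′) n (subst (_≤ d + n) (sym (+-suc d P′)) p≤m)) ⟩
    d + ((suc P′ + suc P′) ⊓ suc (q + q))
      ≡⟨ trans (+-suc d _) (cong (λ x → suc (d + (x ⊓ (q + q)))) (+-suc P′ P′)) ⟩
    suc d + (suc (P′ + P′) ⊓ (q + q))
      ≡⟨ sim-above P′ q q≤p (q≤a q≤n) (s≤s p≤m) ⟨
    sim λ′ (part₂ (suc d + P′) q) ∎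
    where open ≡-Reasoning
  statistic : ∀ p q → p ≤ d + n → q ≤ p → q ≤ n → simθ θ λ′ (part₂ p q) ≡ sim λ′ (part₂ p q)
  statistic p q p≤m q≤p q≤n = [ below , beyond ]′ (≤-<-connex p d)
    where
    below : p ≤ d → simθ θ λ′ (part₂ p q) ≡ sim λ′ (part₂ p q)
    below p≤d = trans (simθ-below p q q≤p q≤n p≤d) (sym (sim-below p q q≤p (q≤a q≤n) (s≤s p≤m) (s≤s p≤d)))
    beyond : d < p → simθ θ λ′ (part₂ p q) ≡ sim λ′ (part₂ p q)
    beyond d<p = subst (λ p → simθ θ λ′ (part₂ p q) ≡ sim λ′ (part₂ p q)) p≡
      (statistic-beyond (p ∸ suc d) q (subst (_≤ d + n) (sym p≡) p≤m) (subst (q ≤_) (sym p≡) q≤p) q≤n)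
      where
      p≡ : suc d + (p ∸ suc d) ≡ p
      p≡ = m+[n∸m]≡n d<p

sim-sym : ∀ d n → n ≤ suc d → SimSym₂ (d + n) n (topDown (part₂ (d + n) n))
sim-sym zero     zero     _     = λ _ _ → refl
sim-sym (suc d′) zero     _     = sim-sym-one-row d′
sim-sym d        (suc n′) n≤1+d = [ (λ d≤n → sim-sym-narrow d n′ d≤n n≤1+d) , sim-sym-wide d n′ ]′
  (≤-<-connex d (suc n′))

along-difference : ∀ {m n} (P : ℕ → ℕ → Set) → n ≤ m → (∀ d → P d (d + n)) → P (m ∸ n) m
along-difference {m} {n} P n≤m p = subst (P (m ∸ n)) (m∸n+n≡m n≤m) (p (m ∸ n))

proposition5p9 : (m n : ℕ) → n ≤ m → Triangular (part₂ m n) →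
    (1 ≤ (m + 2) ∸ 2 * n)
  × ((ℓ c : ℕ) → c < rowLen (part₂ m n) ℓ →
       topDown (part₂ m n) (ℓ , c) ≡ rowRegular m n ((m + 2) ∸ 2 * n) (ℓ , c))
  × ((c : ℕ) → c < n → topDown (part₂ m n) (1 , c) ≡ (m ∸ n) + 2 + 2 * c)
  × ((c : ℕ) → c < m ∸ n → topDown (part₂ m n) (0 , c) ≡ suc c)
  × ((c : ℕ) → m ∸ n ≤ c → c < m →
       topDown (part₂ m n) (0 , c) ≡ (m ∸ n) + 1 + 2 * (c ∸ (m ∸ n)))
  × SimSym₂ m n (topDown (part₂ m n))
proposition5p9 m n n≤m triangular =
    m<n⇒0<n∸m 2n<m+2
  , along-difference (λ d m → 2 * n ≤ m + 2 → ∀ ℓ c → c < rowLen (part₂ m n) ℓ →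
        topDown (part₂ m n) (ℓ , c) ≡ rowRegular m n ((m + 2) ∸ 2 * n) (ℓ , c))
      n≤m (λ d → topDown≡rowRegular d n) (<⇒≤ 2n<m+2)
  , along-difference (λ d m → ∀ c → c < n → topDown (part₂ m n) (1 , c) ≡ d + 2 + 2 * c)
      n≤m (λ d c → topDown-top d n)
  , along-difference (λ d m → ∀ c → c < d → topDown (part₂ m n) (0 , c) ≡ suc c)
      n≤m (λ d c → topDown-bottom-low d n)
  , along-difference (λ d m → ∀ c → d ≤ c → c < m → topDown (part₂ m n) (0 , c) ≡ d + 1 + 2 * (c ∸ d))
      n≤m (λ d → topDown-bottom-beyond d n)
  , along-difference (λ d m → n ≤ suc d → SimSym₂ m n (topDown (part₂ m n))) n≤m (λ d → sim-sym d n) n≤1+d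
  where
  2n<m+2 : 2 * n < m + 2
  2n<m+2 = triangular₂-bound triangular
  n≤1+d : n ≤ suc (m ∸ n)
  n≤1+d = ≤-pred (+-cancelˡ-< n n (suc (suc (m ∸ n))) (subst₂ _<_ (double n) (rearrange (m ∸ n) n)
    (subst (λ m → 2 * n < m + 2) (sym (m∸n+n≡m n≤m)) 2n<m+2)))
    where
    double : ∀ n → 2 * n ≡ n + n
    double = solve-∀
    rearrange : ∀ d n → d + n + 2 ≡ n + suc (suc d)
    rearrange = solve-∀
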